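{- The pattern sets $\{123,132,231\}$, $\{123,132,312\}$ and $\{213,231,312\}$ are extendably Wilf-equivalent. That is, for all $d,c,r\ge0$ the numbers $|\mathcal S_{d,c,r}(\tau)|$ coincide for these three sets $\tau$.
   Context: The permutation matrix of $\sigma\in\mathcal S_n$ is the $n\times n$ $0$-$1$ matrix with a $1$ in position $(i,\sigma(i))$. A partial permutation is a rectangular $0$-$1$ matrix with at most one $1$ ("dot") in each row and column. $\mathcal S_{d,c,r}$ is the set of partial permutations with $d$ dots, $r$ empty rows and $c$ empty columns, so they have size $(d+r)\times(d+c)$. A permutation $\sigma\in\mathcal S_{d+c+r}$ extends $\rho$ if $\rho$ is the upper-left $(d+r)\times(d+c)$ submatrix of $\sigma$'s permutation matrix. $\sigma$ contains $\pi\in\mathcal S_m$ if the permutation matrix of $\pi$ is a submatrix of that of $\sigma$. For a set $\tau$ of patterns, $\mathcal S_{d,c,r}(\tau)$ is the set of $\rho\in\mathcal S_{d,c,r}$ having an extension that avoids all patterns in $\tau$. -}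

module Defs where

open import Data.Nat using (ℕ; zero; suc; _+_; _≤_)
open import Data.Nat.Properties using (+-monoˡ-≤; ≤-refl; m≤m+n; ≤-trans)
open import Data.Fin using (Fin; toℕ; inject≤; _<_)
open import Data.Bool using (Bool; true; false; if_then_else_)
open import Data.Vec using (Vec; []; _∷_; lookup; count; toList)
open import Data.List using (List; length)
open import Data.List.Relation.Unary.All using (All)
open import Data.List.Relation.Unary.Unique.Propositional using (Unique)
open import Data.List.Membership.Propositional using (_∈_)
open import Data.Product using (Σ; ∃; _×_; _,_)
open import Function.Definitions using (Injective)
open import Function.Bundles using (_⇔_)
open import Relation.Binary.PropositionalEquality using (_≡_)
open import Relation.Nullary using (¬_)

-- A rectangular 0-1 matrix with p rows and q columns (true = 1 = "dot").
Matrix : ℕ → ℕ → Set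
Matrix p q = Vec (Vec Bool q) p

entry : ∀ {p q} → Matrix p q → Fin p → Fin q → Bool
entry M i j = lookup (lookup M i) j

ones : ∀ {n} → Vec Bool n → ℕ
ones [] = 0
ones (true ∷ v) = suc (ones v)
ones (false ∷ v) = ones v

row : ∀ {p q} → Matrix p q → Fin p → Vec Bool q
row M i = lookup M i

col : ∀ {p q} → Matrix p q → Fin q → Vec Bool p
col M j = Data.Vec.map (λ r → lookup r j) M

zerosCount : ∀ {n} → (Fin n → ℕ) → ℕ
zerosCount {zero} f = 0
zerosCount {suc n} f with f Fin.zero
... | zero = suc (zerosCount (λ i → f (Fin.suc i)))
... | suc _ = zerosCount (λ i → f (Fin.suc i))

IsPartialPerm : ∀ {p q} → Matrix p q → Set
IsPartialPerm {p} {q} M = (∀ i → ones (row M i) ≤ 1) × (∀ j → ones (col M j) ≤ 1)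

InS : (d c r : ℕ) → Matrix (d + r) (d + c) → Set
InS d c r ρ =
  IsPartialPerm ρ
  × (Data.Vec.sum (Data.Vec.map ones ρ) ≡ d)
  × (zerosCount (λ i → ones (row ρ i)) ≡ r)
  × (zerosCount (λ j → ones (col ρ j)) ≡ c)

IsPerm : ∀ {n} → (Fin n → Fin n) → Set
IsPerm σ = Injective _≡_ _≡_ σ

PermEntry : ∀ {n} → (Fin n → Fin n) → Fin n → Fin n → Set
PermEntry σ i j = σ i ≡ j

rowsFit : ∀ d c r → d + r ≤ d + c + r
rowsFit d c r = +-monoˡ-≤ r (m≤m+n d c)

colsFit : ∀ d c r → d + c ≤ d + c + r
colsFit d c r = m≤m+n (d + c) r

-- σ ∈ S_{d+c+r} extends ρ: ρ is the upper-left (d+r)×(d+c) submatrix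
-- of the permutation matrix of σ.
Extends : (d c r : ℕ) → Matrix (d + r) (d + c) → (Fin (d + c + r) → Fin (d + c + r)) → Set
Extends d c r ρ σ =
  ∀ (i : Fin (d + r)) (j : Fin (d + c)) →
    (entry ρ i j ≡ true) ⇔ PermEntry σ (inject≤ i (rowsFit d c r)) (inject≤ j (colsFit d c r))

StrictlyIncreasing : ∀ {m n} → (Fin m → Fin n) → Set
StrictlyIncreasing f = ∀ a b → a < b → f a < f b

Contains : ∀ {n m} → (Fin n → Fin n) → (Fin m → Fin m) → Set
Contains {n} {m} σ π =
  Σ (Fin m → Fin n) λ f → Σ (Fin m → Fin n) λ g →
    StrictlyIncreasing f × StrictlyIncreasing g ×
    (∀ a b → PermEntry σ (f a) (g b) ⇔ PermEntry π a b)

-- A pattern: a permutation of [m] in one-line notation (0-indexed).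
Pattern : Set
Pattern = Σ ℕ λ m → Vec (Fin m) m

patFun : (π : Pattern) → Fin (Data.Product.proj₁ π) → Fin (Data.Product.proj₁ π)
patFun (m , w) i = lookup w i

Avoids : ∀ {n} → List Pattern → (Fin n → Fin n) → Set
Avoids τ σ = All (λ π → ¬ Contains σ (patFun π)) τ

InSτ : List Pattern → (d c r : ℕ) → Matrix (d + r) (d + c) → Set
InSτ τ d c r ρ =
  InS d c r ρ ×
  Σ (Fin (d + c + r) → Fin (d + c + r)) λ σ → IsPerm σ × Extends d c r ρ σ × Avoids τ σ

HasCard : {A : Set} → (A → Set) → ℕ → Set
HasCard {A} P N = Σ (List A) λ L → Unique L × length L ≡ N × (∀ x → (x ∈ L) ⇔ P x)

-- One-line notation patterns, 1-indexed digits written 0-indexed.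
pat : Vec (Fin 3) 3 → Pattern
pat w = 3 , w

p123 p132 p231 p312 p213 : Pattern
p123 = pat (Fin.zero ∷ Fin.suc Fin.zero ∷ Fin.suc (Fin.suc Fin.zero) ∷ [])
p132 = pat (Fin.zero ∷ Fin.suc (Fin.suc Fin.zero) ∷ Fin.suc Fin.zero ∷ [])
p231 = pat (Fin.suc Fin.zero ∷ Fin.suc (Fin.suc Fin.zero) ∷ Fin.zero ∷ [])
p312 = pat (Fin.suc (Fin.suc Fin.zero) ∷ Fin.zero ∷ Fin.suc Fin.zero ∷ [])
p213 = pat (Fin.suc Fin.zero ∷ Fin.zero ∷ Fin.suc (Fin.suc Fin.zero) ∷ [])

τ₁ τ₂ τ₃ : List Pattern
τ₁ = p123 Data.List.∷ p132 Data.List.∷ p231 Data.List.∷ Data.List.[]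
τ₂ = p123 Data.List.∷ p132 Data.List.∷ p312 Data.List.∷ Data.List.[]
τ₃ = p213 Data.List.∷ p231 Data.List.∷ p312 Data.List.∷ Data.List.[]

-- For each of the three pattern sets τ, the τ-avoiding permutations of [0, n) form a one-parameter
-- family perm t, t < n: for {123, 132, 231} a decreasing permutation with one value moved to the end,
-- for {123, 132, 312} a decreasing permutation with the maximum inserted, and for {213, 231, 312} an
-- increasing run followed by a decreasing one; the avoided patterns force every consecutive ascent and
-- descent. An element of S_{d,c,r}(τ) is the upper-left corner of some perm t with d dots, so it remains
-- to see which t give d dots and which of them give the same corner. In each family exactly d + 1 corners
-- arise when c + r > 0, d when c = r = 0 < d, and 1 when d = c = r = 0.

module Submission where

open import Defs
open import Data.Bool using (Bool; true; false)
open import Data.Bool.Properties using (⇔→≡)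
open import Data.Empty using (⊥-elim)
open import Data.Fin as F using (Fin; toℕ; inject≤; fromℕ<)
open import Data.Fin.Patterns using (0F; 1F; 2F)
open import Data.Fin.Properties
  using (toℕ-injective; toℕ-inject≤; toℕ-fromℕ<; fromℕ<-toℕ; toℕ<n)
import Data.Fin.Properties as FinP
open import Data.List as List using (List; applyUpTo)
open import Data.List.Properties using (length-applyUpTo)
open import Data.List.Membership.Propositional using (_∈_)
open import Data.List.Relation.Unary.Unique.Propositional using (Unique)
open import Data.List.Relation.Unary.Any using (here)
open import Data.List.Membership.Propositional.Properties using (∈-applyUpTo⁺; ∈-applyUpTo⁻)
open import Data.List.Relation.Unary.All as All using (All; _∷_; [])
import Data.List.Relation.Unary.AllPairs as AllPairs
open import Data.List.Relation.Unary.AllPairs.Properties using (applyUpTo⁺₁)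
open import Data.Nat using (ℕ; zero; suc; _+_; _∸_; _≤_; _<_; z≤n; s≤s; _<?_; _≤?_; _≟_)
open import Data.Nat.Properties
open import Algebra.Properties.CommutativeMonoid.Sum +-0-commutativeMonoid
  using (sum; ∑-distrib-+; sum-cong-≗; sum-replicate-zero)
open import Data.Nat.Tactic.RingSolver using (solve-∀)
open import Data.Product using (Σ; ∃; _×_; _,_; proj₁; proj₂)
open import Data.Sum using (_⊎_; inj₁; inj₂)
open import Data.Vec as Vec using (Vec; []; _∷_; lookup; tabulate)
open import Data.Vec.Properties using (lookup∘tabulate; tabulate∘lookup; tabulate-cong; tabulate-∘)
open import Function.Bundles using (_⇔_; mk⇔; Equivalence)
open import Function.Properties.Equivalence using () renaming (trans to ⇔-trans; sym to ⇔-sym)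
open import Relation.Binary.Definitions using (tri<; tri≈; tri>)
open import Relation.Binary.PropositionalEquality
open import Relation.Nullary using (¬_; Dec; yes; no; does; contradiction)
open import Relation.Nullary.Decidable using (dec-true)

-- Outside [0, n) the junk value 0 is returned.
⟦_⟧ : ∀ {n} → (Fin n → Fin n) → ℕ → ℕ
⟦_⟧ {n} σ i with i <? n
... | yes i<n = toℕ (σ (fromℕ< i<n))
... | no _ = 0

_≗ℕ_ : ∀ {n} → (Fin n → Fin n) → (ℕ → ℕ) → Set
_≗ℕ_ {n} σ f = ∀ i → i < n → ⟦ σ ⟧ i ≡ f i

⟦⟧-toℕ : ∀ {n} (σ : Fin n → Fin n) (x : Fin n) → ⟦ σ ⟧ (toℕ x) ≡ toℕ (σ x)
⟦⟧-toℕ {n} σ x with toℕ x <? n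
... | yes p = cong (λ y → toℕ (σ y)) (fromℕ<-toℕ x p)
... | no ¬p = contradiction (toℕ<n x) ¬p

⟦⟧-< : ∀ {n} (σ : Fin n → Fin n) i → i < n → ⟦ σ ⟧ i < n
⟦⟧-< {n} σ i i<n with i <? n
... | yes _ = toℕ<n _
... | no ¬p = contradiction i<n ¬p

⟦⟧-injective : ∀ {n} (σ : Fin n → Fin n) → IsPerm σ →
               ∀ i j → i < n → j < n → ⟦ σ ⟧ i ≡ ⟦ σ ⟧ j → i ≡ j
⟦⟧-injective {n} σ inj i j i<n j<n e with i <? n | j <? n
... | yes p | yes q = trans (sym (toℕ-fromℕ< p)) (trans (cong toℕ (inj (toℕ-injective e))) (toℕ-fromℕ< q))
... | no ¬p | _ = contradiction i<n ¬p
... | yes _ | no ¬q = contradiction j<n ¬q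

⟦⟧-<⊎> : ∀ {n} (σ : Fin n → Fin n) → IsPerm σ → ∀ i j → i < n → j < n → i ≢ j →
                ⟦ σ ⟧ i < ⟦ σ ⟧ j ⊎ ⟦ σ ⟧ j < ⟦ σ ⟧ i
⟦⟧-<⊎> σ inj i j i<n j<n i≢j with <-cmp (⟦ σ ⟧ i) (⟦ σ ⟧ j)
... | tri< lt _ _ = inj₁ lt
... | tri≈ _ e _ = contradiction (⟦⟧-injective σ inj i j i<n j<n e) i≢j
... | tri> _ _ gt = inj₂ gt

AtMostOnce : ∀ {m} → (Fin m → Bool) → Set
AtMostOnce g = ∀ a b → g a ≡ true → g b ≡ true → a ≡ b

ones-tabulate-none : ∀ {m} (g : Fin m → Bool) → (∀ j → g j ≡ false) → ones (tabulate g) ≡ 0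
ones-tabulate-none {zero} g none = refl
ones-tabulate-none {suc m} g none with g F.zero | none F.zero
... | false | _ = ones-tabulate-none (λ j → g (F.suc j)) (λ j → none (F.suc j))

ones-tabulate-≤1 : ∀ {m} (g : Fin m → Bool) → AtMostOnce g → ones (tabulate g) ≤ 1
ones-tabulate-≤1 {zero} g once = z≤n
ones-tabulate-≤1 {suc m} g once with g F.zero in g0
... | false = ones-tabulate-≤1 (λ j → g (F.suc j)) (λ a b ga gb → FinP.suc-injective (once (F.suc a) (F.suc b) ga gb))
... | true = s≤s (≤-reflexive (ones-tabulate-none (λ j → g (F.suc j)) rest))
  where
  rest : ∀ j → g (F.suc j) ≡ false
  rest j with g (F.suc j) in gj
  ... | false = refl
  ... | true with once F.zero (F.suc j) g0 gj
  ...   | ()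

ones-tabulate-≡1 : ∀ {m} (g : Fin m → Bool) (j : Fin m) → g j ≡ true → AtMostOnce g → ones (tabulate g) ≡ 1
ones-tabulate-≡1 g j gj once = ≤-antisym (ones-tabulate-≤1 g once) (positive g j gj)
  where
  positive : ∀ {m} (g : Fin m → Bool) (j : Fin m) → g j ≡ true → 1 ≤ ones (tabulate g)
  positive g F.zero gj rewrite gj = s≤s z≤n
  positive g (F.suc j) gj with g F.zero
  ... | true = s≤s z≤n
  ... | false = positive (λ i → g (F.suc i)) j gj

ones-∷ : ∀ {m} b (v : Vec Bool m) → ones (b ∷ v) ≡ ones (b ∷ []) + ones v
ones-∷ true v = refl
ones-∷ false v = refl

∑-ones : ∀ {m} (v : Vec Bool m) → sum (λ j → ones (lookup v j ∷ [])) ≡ ones v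
∑-ones [] = refl
∑-ones (b ∷ v) = trans (cong (ones (b ∷ []) +_) (∑-ones v)) (sym (ones-∷ b v))

∑-ones-rows : ∀ {p q} (M : Matrix p q) → Vec.sum (Vec.map ones M) ≡ sum (λ i → ones (row M i))
∑-ones-rows [] = refl
∑-ones-rows (v ∷ M) = cong (ones v +_) (∑-ones-rows M)

∑-ones-cols : ∀ {p q} (M : Matrix p q) → sum (λ j → ones (col M j)) ≡ Vec.sum (Vec.map ones M)
∑-ones-cols {q = q} [] = sum-replicate-zero q
∑-ones-cols (v ∷ M) = begin
    sum (λ j → ones (lookup v j ∷ col M j))
      ≡⟨ sum-cong-≗ (λ j → ones-∷ (lookup v j) (col M j)) ⟩
    sum (λ j → ones (lookup v j ∷ []) + ones (col M j))
      ≡⟨ ∑-distrib-+ (λ j → ones (lookup v j ∷ [])) (λ j → ones (col M j)) ⟩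
    sum (λ j → ones (lookup v j ∷ [])) + sum (λ j → ones (col M j))
      ≡⟨ cong₂ _+_ (∑-ones v) (∑-ones-cols M) ⟩
    ones v + Vec.sum (Vec.map ones M) ∎
  where open ≡-Reasoning

zerosCount+sum : ∀ {m} (f : Fin m → ℕ) → (∀ i → f i ≤ 1) → zerosCount f + sum f ≡ m
zerosCount+sum {zero} f f≤1 = refl
zerosCount+sum {suc m} f f≤1 with f F.zero | f≤1 F.zero
... | zero | _ = cong suc (zerosCount+sum (λ i → f (F.suc i)) (λ i → f≤1 (F.suc i)))
... | suc zero | _ = trans (+-suc _ _) (cong suc (zerosCount+sum (λ i → f (F.suc i)) (λ i → f≤1 (F.suc i))))
... | suc (suc _) | s≤s ()

-- The upper-left R × C corner of a permutation matrix

module Restriction {n R C : ℕ} (R≤n : R ≤ n) (C≤n : C ≤ n) where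

  liftRow : Fin R → Fin n
  liftRow i = inject≤ i R≤n

  liftCol : Fin C → Fin n
  liftCol j = inject≤ j C≤n

  toℕ-liftRow : ∀ i → toℕ (liftRow i) ≡ toℕ i
  toℕ-liftRow i = toℕ-inject≤ i R≤n

  toℕ-liftCol : ∀ j → toℕ (liftCol j) ≡ toℕ j
  toℕ-liftCol j = toℕ-inject≤ j C≤n

  liftRow-injective : ∀ a b → liftRow a ≡ liftRow b → a ≡ b
  liftRow-injective a b e = toℕ-injective (trans (sym (toℕ-liftRow a)) (trans (cong toℕ e) (toℕ-liftRow b)))

  liftCol-injective : ∀ a b → liftCol a ≡ liftCol b → a ≡ b
  liftCol-injective a b e = toℕ-injective (trans (sym (toℕ-liftCol a)) (trans (cong toℕ e) (toℕ-liftCol b)))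

  hasDot : (Fin n → Fin n) → Fin R → Fin C → Bool
  hasDot σ i j = does (σ (liftRow i) F.≟ liftCol j)

  hasDot⇒ : ∀ σ i j → hasDot σ i j ≡ true → σ (liftRow i) ≡ liftCol j
  hasDot⇒ σ i j e with σ (liftRow i) F.≟ liftCol j
  ... | yes p = p

  ⇒hasDot : ∀ σ i j → σ (liftRow i) ≡ liftCol j → hasDot σ i j ≡ true
  ⇒hasDot σ i j = dec-true (σ (liftRow i) F.≟ liftCol j)

  ⟦⟧-liftRow : ∀ σ i → ⟦ σ ⟧ (toℕ i) ≡ toℕ (σ (liftRow i))
  ⟦⟧-liftRow σ i = trans (cong ⟦ σ ⟧ (sym (toℕ-liftRow i))) (⟦⟧-toℕ σ (liftRow i))

  hasDot⇔ : ∀ σ i j → (hasDot σ i j ≡ true) ⇔ (⟦ σ ⟧ (toℕ i) ≡ toℕ j)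
  hasDot⇔ σ i j = mk⇔
    (λ e → trans (⟦⟧-liftRow σ i) (trans (cong toℕ (hasDot⇒ σ i j e)) (toℕ-liftCol j)))
    (λ e → ⇒hasDot σ i j (toℕ-injective (trans (sym (⟦⟧-liftRow σ i)) (trans e (sym (toℕ-liftCol j))))))

  restrict : (Fin n → Fin n) → Matrix R C
  restrict σ = tabulate λ i → tabulate λ j → hasDot σ i j

  entry-restrict : ∀ σ i j → entry (restrict σ) i j ≡ hasDot σ i j
  entry-restrict σ i j = trans (cong (λ v → lookup v j) (lookup∘tabulate _ i)) (lookup∘tabulate _ j)

  row-restrict : ∀ σ i → row (restrict σ) i ≡ tabulate (hasDot σ i)
  row-restrict σ i = lookup∘tabulate _ i

  col-restrict : ∀ σ j → col (restrict σ) j ≡ tabulate (λ i → hasDot σ i j)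
  col-restrict σ j = trans (sym (tabulate-∘ (λ v → lookup v j) (λ i → tabulate (hasDot σ i))))
                           (tabulate-cong (λ i → lookup∘tabulate (hasDot σ i) j))

  hasDot-row-once : ∀ σ i → AtMostOnce (hasDot σ i)
  hasDot-row-once σ i a b ha hb = liftCol-injective a b (trans (sym (hasDot⇒ σ i a ha)) (hasDot⇒ σ i b hb))

  restrict-isPartialPerm : ∀ σ → IsPerm σ → IsPartialPerm (restrict σ)
  restrict-isPartialPerm σ inj = rows , cols
    where
    rows : ∀ i → ones (row (restrict σ) i) ≤ 1
    rows i rewrite row-restrict σ i = ones-tabulate-≤1 (hasDot σ i) (hasDot-row-once σ i)
    cols : ∀ j → ones (col (restrict σ) j) ≤ 1
    cols j rewrite col-restrict σ j = ones-tabulate-≤1 (λ i → hasDot σ i j)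
      (λ a b ha hb → liftRow-injective a b (inj (trans (hasDot⇒ σ a j ha) (sym (hasDot⇒ σ b j hb)))))

  restrict-extends : ∀ σ i j → (entry (restrict σ) i j ≡ true) ⇔ (σ (liftRow i) ≡ liftCol j)
  restrict-extends σ i j = mk⇔ (λ e → hasDot⇒ σ i j (trans (sym (entry-restrict σ i j)) e))
                               (λ e → trans (entry-restrict σ i j) (⇒hasDot σ i j e))

  extends⇒≡restrict : ∀ (ρ : Matrix R C) σ → (∀ i j → (entry ρ i j ≡ true) ⇔ (σ (liftRow i) ≡ liftCol j)) →
                      ρ ≡ restrict σ
  extends⇒≡restrict ρ σ ext =
    trans (sym (trans (tabulate-cong (λ i → tabulate∘lookup (lookup ρ i))) (tabulate∘lookup ρ)))
          (tabulate-cong (λ i → tabulate-cong (λ j → pointwise i j)))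
    where
    pointwise : ∀ i j → entry ρ i j ≡ hasDot σ i j
    pointwise i j = ⇔→≡ (⇔-trans (ext i j) (mk⇔ (⇒hasDot σ i j) (hasDot⇒ σ i j)))

  -- Row i of the corner of σ carries a dot iff σ i < C.
  isDot : ℕ → ℕ
  isDot v with v <? C
  ... | yes _ = 1
  ... | no _ = 0

  isDot-< : ∀ v → v < C → isDot v ≡ 1
  isDot-< v v<C with v <? C
  ... | yes _ = refl
  ... | no ¬p = contradiction v<C ¬p

  isDot-≥ : ∀ v → C ≤ v → isDot v ≡ 0
  isDot-≥ v C≤v with v <? C
  ... | yes p = contradiction C≤v (<⇒≱ p)
  ... | no _ = refl

  ones-row-restrict : ∀ σ i → ones (row (restrict σ) i) ≡ isDot (toℕ (σ (liftRow i)))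
  ones-row-restrict σ i rewrite row-restrict σ i with toℕ (σ (liftRow i)) <? C
  ... | yes p = ones-tabulate-≡1 (hasDot σ i) (fromℕ< p)
          (⇒hasDot σ i _ (toℕ-injective (trans (sym (toℕ-fromℕ< p)) (sym (toℕ-liftCol (fromℕ< p))))))
          (hasDot-row-once σ i)
  ... | no ¬p = ones-tabulate-none (hasDot σ i) none
    where
    none : ∀ j → hasDot σ i j ≡ false
    none j with hasDot σ i j in e
    ... | false = refl
    ... | true = contradiction (subst (_< C) (sym (trans (cong toℕ (hasDot⇒ σ i j e)) (toℕ-liftCol j))) (toℕ<n j)) ¬p

  dotsIn : (ℕ → ℕ) → ℕ → ℕ → ℕ
  dotsIn h a zero = 0
  dotsIn h a (suc k) = isDot (h a) + dotsIn h (suc a) k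

  dots[_,_⟩ : ℕ → ℕ → (ℕ → ℕ) → ℕ
  dots[ a , b ⟩ h = dotsIn h a (b ∸ a)

  a<a+suc : ∀ a k → a < a + suc k
  a<a+suc a k = subst (a <_) (sym (+-suc a k)) (s≤s (m≤m+n a k))

  shiftRange : ∀ {a i k} → suc a ≤ i → i < suc a + k → a ≤ i × i < a + suc k
  shiftRange {a} {i} {k} a<i i<ak = <⇒≤ a<i , subst (i <_) (sym (+-suc a k)) i<ak

  dotsIn-cong : ∀ h h′ a k → (∀ i → a ≤ i → i < a + k → h i ≡ h′ i) → dotsIn h a k ≡ dotsIn h′ a k
  dotsIn-cong h h′ a zero e = refl
  dotsIn-cong h h′ a (suc k) e =
    cong₂ _+_ (cong isDot (e a ≤-refl (a<a+suc a k)))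
              (dotsIn-cong h h′ (suc a) k (λ i a<i i<ak → let a≤i , i<ak′ = shiftRange a<i i<ak in e i a≤i i<ak′))

  dotsIn-all : ∀ h a k → (∀ i → a ≤ i → i < a + k → h i < C) → dotsIn h a k ≡ k
  dotsIn-all h a zero all = refl
  dotsIn-all h a (suc k) all =
    cong₂ _+_ (isDot-< (h a) (all a ≤-refl (a<a+suc a k)))
              (dotsIn-all h (suc a) k (λ i a<i i<ak → let a≤i , i<ak′ = shiftRange a<i i<ak in all i a≤i i<ak′))

  dotsIn-none : ∀ h a k → (∀ i → a ≤ i → i < a + k → C ≤ h i) → dotsIn h a k ≡ 0
  dotsIn-none h a zero none = refl
  dotsIn-none h a (suc k) none =
    cong₂ _+_ (isDot-≥ (h a) (none a ≤-refl (a<a+suc a k)))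
              (dotsIn-none h (suc a) k (λ i a<i i<ak → let a≤i , i<ak′ = shiftRange a<i i<ak in none i a≤i i<ak′))

  dotsIn-+ : ∀ h a k l → dotsIn h a (k + l) ≡ dotsIn h a k + dotsIn h (a + k) l
  dotsIn-+ h a zero l = cong (λ b → dotsIn h b l) (sym (+-identityʳ a))
  dotsIn-+ h a (suc k) l =
    trans (cong (isDot (h a) +_) (trans (dotsIn-+ h (suc a) k l) (cong (λ b → dotsIn h (suc a) k + dotsIn h b l) (sym (+-suc a k)))))
          (sym (+-assoc (isDot (h a)) _ _))

  ∑-isDot : ∀ (h : ℕ → ℕ) a m → sum {m} (λ i → isDot (h (a + toℕ i))) ≡ dotsIn h a m
  ∑-isDot h a zero = refl
  ∑-isDot h a (suc m) =
    cong₂ _+_ (cong (λ x → isDot (h x)) (+-identityʳ a))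
              (trans (sum-cong-≗ {m} (λ i → cong (λ x → isDot (h x)) (+-suc a (toℕ i)))) (∑-isDot h (suc a) m))

  ∑-ones-restrict : ∀ σ → Vec.sum (Vec.map ones (restrict σ)) ≡ dots[ 0 , R ⟩ ⟦ σ ⟧
  ∑-ones-restrict σ = begin
      Vec.sum (Vec.map ones (restrict σ))         ≡⟨ ∑-ones-rows (restrict σ) ⟩
      sum (λ i → ones (row (restrict σ) i))        ≡⟨ sum-cong-≗ (ones-row-restrict σ) ⟩
      sum (λ i → isDot (toℕ (σ (liftRow i))))      ≡⟨ sum-cong-≗ (λ i → cong isDot (toℕ-σ i)) ⟩
      sum {R} (λ i → isDot (⟦ σ ⟧ (0 + toℕ i)))    ≡⟨ ∑-isDot ⟦ σ ⟧ 0 R ⟩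
      dots[ 0 , R ⟩ ⟦ σ ⟧                             ∎
    where
    open ≡-Reasoning
    toℕ-σ : ∀ i → toℕ (σ (liftRow i)) ≡ ⟦ σ ⟧ (toℕ i)
    toℕ-σ i = sym (⟦⟧-liftRow σ i)

  dots-split : ∀ h a m b → a ≤ m → m ≤ b → dots[ a , b ⟩ h ≡ dots[ a , m ⟩ h + dots[ m , b ⟩ h
  dots-split h a m b a≤m m≤b =
    trans (cong (dotsIn h a) lengths)
          (trans (dotsIn-+ h a (m ∸ a) (b ∸ m)) (cong (λ z → dotsIn h a (m ∸ a) + dotsIn h z (b ∸ m)) (m+[n∸m]≡n a≤m)))
    where
    lengths : b ∸ a ≡ (m ∸ a) + (b ∸ m)
    lengths = +-cancelˡ-≡ a _ _ (trans (m+[n∸m]≡n (≤-trans a≤m m≤b))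
                (sym (trans (sym (+-assoc a (m ∸ a) (b ∸ m))) (trans (cong (_+ (b ∸ m)) (m+[n∸m]≡n a≤m)) (m+[n∸m]≡n m≤b)))))

  dots-all : ∀ h a b → a ≤ b → (∀ i → a ≤ i → i < b → h i < C) → dots[ a , b ⟩ h ≡ b ∸ a
  dots-all h a b a≤b all = dotsIn-all h a (b ∸ a) (λ i a≤i i<b → all i a≤i (subst (i <_) (m+[n∸m]≡n a≤b) i<b))

  dots-none : ∀ h a b → a ≤ b → (∀ i → a ≤ i → i < b → C ≤ h i) → dots[ a , b ⟩ h ≡ 0
  dots-none h a b a≤b none = dotsIn-none h a (b ∸ a) (λ i a≤i i<b → none i a≤i (subst (i <_) (m+[n∸m]≡n a≤b) i<b))

  1+n∸n≡1 : ∀ a → suc a ∸ a ≡ 1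
  1+n∸n≡1 zero = refl
  1+n∸n≡1 (suc a) = 1+n∸n≡1 a

  dots-one : ∀ h a → h a < C → dots[ a , suc a ⟩ h ≡ 1
  dots-one h a lt rewrite 1+n∸n≡1 a = trans (+-identityʳ _) (isDot-< (h a) lt)

  dots-zero : ∀ h a → C ≤ h a → dots[ a , suc a ⟩ h ≡ 0
  dots-zero h a le rewrite 1+n∸n≡1 a = trans (+-identityʳ _) (isDot-≥ (h a) le)

  AgreeOnDots : (ℕ → ℕ) → (ℕ → ℕ) → Set
  AgreeOnDots s s′ = ∀ i → i < R → s i ≡ s′ i ⊎ (C ≤ s i × C ≤ s′ i)

  restrict-cong : ∀ σ σ′ → AgreeOnDots ⟦ σ ⟧ ⟦ σ′ ⟧ → restrict σ ≡ restrict σ′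
  restrict-cong σ σ′ agree = tabulate-cong (λ i → tabulate-cong (λ j → ⇔→≡ (sameDot i j)))
    where
    sameDot : ∀ i j → (hasDot σ i j ≡ true) ⇔ (hasDot σ′ i j ≡ true)
    sameDot i j with agree (toℕ i) (toℕ<n i)
    ... | inj₁ e = ⇔-trans (hasDot⇔ σ i j) (⇔-trans (mk⇔ (trans (sym e)) (trans e)) (⇔-sym (hasDot⇔ σ′ i j)))
    ... | inj₂ (C≤σi , C≤σ′i) = mk⇔ (λ h → ⊥-elim (noDot σ C≤σi h)) (λ h → ⊥-elim (noDot σ′ C≤σ′i h))
      where
      noDot : ∀ τ → C ≤ ⟦ τ ⟧ (toℕ i) → ¬ (hasDot τ i j ≡ true)
      noDot τ C≤ h = <⇒≱ (subst (_< C) (sym (Equivalence.to (hasDot⇔ τ i j) h)) (toℕ<n j)) C≤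

  restrict-≢ : ∀ σ σ′ i → i < R → ⟦ σ ⟧ i < C → ⟦ σ ⟧ i ≢ ⟦ σ′ ⟧ i → restrict σ ≢ restrict σ′
  restrict-≢ σ σ′ i i<R σi<C σi≢σ′i same = σi≢σ′i (sym (trans (cong ⟦ σ′ ⟧ (sym i≡)) (trans σ′dot j≡)))
    where
    i′ = fromℕ< i<R
    j′ = fromℕ< σi<C
    i≡ : toℕ i′ ≡ i
    i≡ = toℕ-fromℕ< i<R
    j≡ : toℕ j′ ≡ ⟦ σ ⟧ i
    j≡ = toℕ-fromℕ< σi<C
    σdot : hasDot σ i′ j′ ≡ true
    σdot = Equivalence.from (hasDot⇔ σ i′ j′) (trans (cong ⟦ σ ⟧ i≡) (sym j≡))
    σ′dot : ⟦ σ′ ⟧ (toℕ i′) ≡ toℕ j′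
    σ′dot = Equivalence.to (hasDot⇔ σ′ i′ j′)
              (trans (sym (entry-restrict σ′ i′ j′))
                     (trans (cong (λ M → entry M i′ j′) (sym same)) (trans (entry-restrict σ i′ j′) σdot)))

record Inverse₃ (w : Vec (Fin 3) 3) : Set where
  field
    position : Fin 3 → Fin 3
    lookup-position : ∀ v → lookup w (position v) ≡ v
    position-lookup : ∀ a → position (lookup w a) ≡ a

triple : ℕ → ℕ → ℕ → Fin 3 → ℕ
triple i j k = lookup (i ∷ j ∷ k ∷ [])

triple-increasing : ∀ {i j k} → i < j → j < k → ∀ a b → a F.< b → triple i j k a < triple i j k b
triple-increasing i<j j<k 0F 1F _ = i<j
triple-increasing i<j j<k 0F 2F _ = <-trans i<j j<k
triple-increasing i<j j<k 1F 2F _ = j<k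
triple-increasing i<j j<k 1F 1F (s≤s ())
triple-increasing i<j j<k 2F 2F (s≤s (s≤s ()))

triple-< : ∀ {i j k n} → i < j → j < k → k < n → ∀ a → triple i j k a < n
triple-< i<j j<k k<n 0F = <-trans i<j (<-trans j<k k<n)
triple-< i<j j<k k<n 1F = <-trans j<k k<n
triple-< i<j j<k k<n 2F = k<n

-- Positions i < j < k < n whose values under s are ordered like the values 0, 1, 2 of the pattern.
Occurrence : (Fin 3 → Fin 3) → (ℕ → ℕ) → ℕ → Set
Occurrence position s n =
  Σ ℕ λ i → Σ ℕ λ j → Σ ℕ λ k → (i < j × j < k × k < n) ×
    let at = λ v → s (triple i j k (position v)) in
    at 0F < at 1F × at 1F < at 2F

module _ {w : Vec (Fin 3) 3} (inverse : Inverse₃ w) {n : ℕ} (σ : Fin n → Fin n) (inj : IsPerm σ) where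
  open Inverse₃ inverse

  occurrence⇒contains : Occurrence position ⟦ σ ⟧ n → Contains σ (lookup w)
  occurrence⇒contains (i , j , k , (i<j , j<k , k<n) , low<mid , mid<high) = f , g , f-increasing , g-increasing , iff
    where
    x = triple i j k
    x-increasing = triple-increasing i<j j<k
    x<n = triple-< i<j j<k k<n
    values-increasing : ∀ v v′ → v F.< v′ → ⟦ σ ⟧ (x (position v)) < ⟦ σ ⟧ (x (position v′))
    values-increasing 0F 1F _ = low<mid
    values-increasing 0F 2F _ = <-trans low<mid mid<high
    values-increasing 1F 2F _ = mid<high
    values-increasing 1F 1F (s≤s ())
    values-increasing 2F 2F (s≤s (s≤s ()))
    f : Fin 3 → Fin n
    f a = fromℕ< (x<n a)
    toℕ-f : ∀ a → toℕ (f a) ≡ x a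
    toℕ-f a = toℕ-fromℕ< (x<n a)
    g : Fin 3 → Fin n
    g v = σ (f (position v))
    toℕ-σf : ∀ a → toℕ (σ (f a)) ≡ ⟦ σ ⟧ (x a)
    toℕ-σf a = trans (sym (⟦⟧-toℕ σ (f a))) (cong ⟦ σ ⟧ (toℕ-f a))
    f-increasing : StrictlyIncreasing f
    f-increasing a b a<b = subst₂ _<_ (sym (toℕ-f a)) (sym (toℕ-f b)) (x-increasing a b a<b)
    g-increasing : StrictlyIncreasing g
    g-increasing v v′ v<v′ =
      subst₂ _<_ (sym (toℕ-σf (position v))) (sym (toℕ-σf (position v′))) (values-increasing v v′ v<v′)
    x-injective : ∀ a b → x a ≡ x b → a ≡ b
    x-injective a b e with FinP.<-cmp a b
    ... | tri< lt _ _ = ⊥-elim (<-irrefl e (x-increasing a b lt))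
    ... | tri≈ _ eq _ = eq
    ... | tri> _ _ gt = ⊥-elim (<-irrefl (sym e) (x-increasing b a gt))
    iff : ∀ a v → PermEntry σ (f a) (g v) ⇔ PermEntry (lookup w) a v
    iff a v = mk⇔
      (λ e → trans (cong (lookup w) (x-injective a (position v) (trans (sym (toℕ-f a)) (trans (cong toℕ (inj e)) (toℕ-f (position v))))))
                   (lookup-position v))
      (λ e → cong (λ b → σ (f b)) (trans (sym (position-lookup a)) (cong position e)))

  contains⇒occurrence : Contains σ (lookup w) → Occurrence position ⟦ σ ⟧ n
  contains⇒occurrence (f , g , f-increasing , g-increasing , iff) =
    x 0F , x 1F , x 2F ,
    (f-increasing 0F 1F (s≤s z≤n) , f-increasing 1F 2F (s≤s (s≤s z≤n)) ,
     toℕ<n (f 2F)) ,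
    ordered 0F 1F (s≤s z≤n) , ordered 1F 2F (s≤s (s≤s z≤n))
    where
    x : Fin 3 → ℕ
    x a = toℕ (f a)
    triple-x : ∀ a → triple (x 0F) (x 1F) (x 2F) a ≡ x a
    triple-x 0F = refl
    triple-x 1F = refl
    triple-x 2F = refl
    value : ∀ v → ⟦ σ ⟧ (x (position v)) ≡ toℕ (g v)
    value v = trans (⟦⟧-toℕ σ (f (position v)))
                    (cong toℕ (subst (λ u → σ (f (position v)) ≡ g u) (lookup-position v)
                                     (Equivalence.from (iff (position v) (lookup w (position v))) refl)))
    ordered : ∀ v v′ → v F.< v′ →
              ⟦ σ ⟧ (triple (x 0F) (x 1F) (x 2F) (position v))
              < ⟦ σ ⟧ (triple (x 0F) (x 1F) (x 2F) (position v′))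
    ordered v v′ v<v′ = subst₂ (λ a b → ⟦ σ ⟧ a < ⟦ σ ⟧ b) (sym (triple-x (position v))) (sym (triple-x (position v′)))
                         (subst₂ _<_ (sym (value v)) (sym (value v′)) (g-increasing v v′ v<v′))

fin₃-cases : {P : Fin 3 → Set} → P 0F → P 1F → P 2F → ∀ a → P a
fin₃-cases p₀ p₁ p₂ 0F = p₀
fin₃-cases p₀ p₁ p₂ 1F = p₁
fin₃-cases p₀ p₁ p₂ 2F = p₂

inverseBy : (w u : Vec (Fin 3) 3) → (∀ v → lookup w (lookup u v) ≡ v) → (∀ a → lookup u (lookup w a) ≡ a) → Inverse₃ w
inverseBy w u wu uw = record { position = lookup u ; lookup-position = wu ; position-lookup = uw }

inverse₁₂₃ : Inverse₃ (proj₂ p123)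
inverse₁₂₃ = inverseBy _ (0F ∷ 1F ∷ 2F ∷ []) (fin₃-cases refl refl refl) (fin₃-cases refl refl refl)

inverse₁₃₂ : Inverse₃ (proj₂ p132)
inverse₁₃₂ = inverseBy _ (0F ∷ 2F ∷ 1F ∷ []) (fin₃-cases refl refl refl) (fin₃-cases refl refl refl)

inverse₂₃₁ : Inverse₃ (proj₂ p231)
inverse₂₃₁ = inverseBy _ (2F ∷ 0F ∷ 1F ∷ []) (fin₃-cases refl refl refl) (fin₃-cases refl refl refl)

inverse₃₁₂ : Inverse₃ (proj₂ p312)
inverse₃₁₂ = inverseBy _ (1F ∷ 2F ∷ 0F ∷ []) (fin₃-cases refl refl refl) (fin₃-cases refl refl refl)

inverse₂₁₃ : Inverse₃ (proj₂ p213)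
inverse₂₁₃ = inverseBy _ (1F ∷ 0F ∷ 2F ∷ []) (fin₃-cases refl refl refl) (fin₃-cases refl refl refl)

+≡+⇒< : ∀ {a b a′ b′} → a + b ≡ a′ + b′ → b < b′ → a′ < a
+≡+⇒< {a} {b} {a′} {b′} e b<b′ with a′ <? a
... | yes a′<a = a′<a
... | no a′≮a = ⊥-elim (<-irrefl e (+-mono-≤-< (≮⇒≥ a′≮a) b<b′))

+≡+⇒≤ : ∀ {a b a′ b′} → a + b ≡ a′ + b′ → b ≤ b′ → a′ ≤ a
+≡+⇒≤ {a} {b} {a′} {b′} e b≤b′ with a′ ≤? a
... | yes a′≤a = a′≤a
... | no a′≰a = ⊥-elim (<-irrefl e (+-mono-<-≤ (≰⇒> a′≰a) b≤b′))

DescendsOn : (ℕ → ℕ) → ℕ → ℕ → Set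
DescendsOn s a b = ∀ i → a ≤ i → suc i < b → s (suc i) < s i

AscendsBelow : (ℕ → ℕ) → ℕ → Set
AscendsBelow s b = ∀ i → suc i < b → s i < s (suc i)

i+k<b⇒ : ∀ {i k b} → i + suc k < b → i + k < b × suc (i + k) < b
i+k<b⇒ {i} {k} {b} lt = <-trans (subst (i + k <_) (sym (+-suc i k)) (n<1+n _)) lt , subst (_< b) (+-suc i k) lt

descent : ∀ s {a b} → DescendsOn s a b → ∀ i k → a ≤ i → i + k < b → s (i + k) + k ≤ s i
descent s down i zero a≤i lt = ≤-reflexive (trans (+-identityʳ _) (cong s (+-identityʳ i)))
descent s down i (suc k) a≤i lt = begin
    s (i + suc k) + suc k      ≡⟨ +-suc _ k ⟩
    suc (s (i + suc k) + k)    ≡⟨ cong (λ z → suc (s z + k)) (+-suc i k) ⟩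
    suc (s (suc (i + k)) + k)  ≤⟨ +-monoˡ-≤ k (down (i + k) (≤-trans a≤i (m≤m+n i k)) (proj₂ (i+k<b⇒ lt))) ⟩
    s (i + k) + k              ≤⟨ descent s down i k a≤i (proj₁ (i+k<b⇒ lt)) ⟩
    s i                        ∎
  where open ≤-Reasoning

descent′ : ∀ s {a b} → DescendsOn s a b → ∀ i j → a ≤ i → i ≤ j → j < b → s j + (j ∸ i) ≤ s i
descent′ s down i j a≤i i≤j j<b =
  subst (λ z → s z + (j ∸ i) ≤ s i) (m+[n∸m]≡n i≤j) (descent s down i (j ∸ i) a≤i (subst (_< _) (sym (m+[n∸m]≡n i≤j)) j<b))

ascent′ : ∀ s {b} → AscendsBelow s b → ∀ i j → i ≤ j → j < b → s i + (j ∸ i) ≤ s j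
ascent′ s {b} up i j i≤j j<b =
  subst (λ z → s i + (j ∸ i) ≤ s z) (m+[n∸m]≡n i≤j) (go (j ∸ i) (subst (_< b) (sym (m+[n∸m]≡n i≤j)) j<b))
  where
  go : ∀ k → i + k < b → s i + k ≤ s (i + k)
  go zero _ = ≤-reflexive (trans (+-identityʳ _) (cong s (sym (+-identityʳ i))))
  go (suc k) lt = begin
      s i + suc k          ≡⟨ +-suc _ k ⟩
      suc (s i + k)        ≤⟨ s≤s (go k (proj₁ (i+k<b⇒ lt))) ⟩
      suc (s (i + k))      ≤⟨ up (i + k) (proj₂ (i+k<b⇒ lt)) ⟩
      s (suc (i + k))      ≡⟨ cong s (sym (+-suc i k)) ⟩
      s (i + suc k)        ∎
    where open ≤-Reasoning

ascent-< : ∀ s {b} → AscendsBelow s b → ∀ i j → i < j → j < b → s i < s j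
ascent-< s up i j i<j j<b =
  <-≤-trans (subst (_< s i + (j ∸ i)) (+-identityʳ (s i)) (+-monoʳ-< (s i) (m<n⇒0<n∸m i<j))) (ascent′ s up i j (<⇒≤ i<j) j<b)

stepwise⇒upward : (Q : ℕ → Set) (m : ℕ) → (∀ i → suc i < m → Q i → Q (suc i)) →
                  ∀ i j → i ≤ j → j < m → Q i → Q j
stepwise⇒upward Q m step i j i≤j j<m q = subst Q (m+[n∸m]≡n i≤j) (go (j ∸ i) (subst (_< m) (sym (m+[n∸m]≡n i≤j)) j<m))
  where
  go : ∀ k → i + k < m → Q (i + k)
  go zero _ = subst Q (sym (+-identityʳ i)) q
  go (suc k) lt = subst Q (sym (+-suc i k)) (step (i + k) (proj₂ (i+k<b⇒ lt)) (go k (proj₁ (i+k<b⇒ lt))))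

all-<⇒≤ : ∀ {p x} → (∀ i → i < p → i < x) → p ≤ x
all-<⇒≤ {zero} _ = z≤n
all-<⇒≤ {suc p} below = below p (n<1+n p)

threshold : (Q : ℕ → Set) → (∀ i → Dec (Q i)) → ∀ m → (∀ i j → i ≤ j → j < m → Q i → Q j) →
            Σ ℕ λ p → p ≤ m × (∀ i → i < m → i < p → ¬ Q i) × (∀ i → i < m → p ≤ i → Q i)
threshold Q Q? zero up = 0 , z≤n , (λ i i<0 _ → ⊥-elim (n≮0 i<0)) , (λ i i<0 _ → ⊥-elim (n≮0 i<0))
threshold Q Q? (suc m) up with threshold Q Q? m (λ i j i≤j j<m → up i j i≤j (<-trans j<m (n<1+n m)))
... | p , p≤m , below , above with m≤n⇒m<n∨m≡n p≤m
...   | inj₁ p<m = p , ≤-trans p≤m (n≤1+n m) , (λ i _ i<p → below i (<-trans i<p p<m) i<p) , above′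
  where
  above′ : ∀ i → i < suc m → p ≤ i → Q i
  above′ i i<1+m p≤i with m≤n⇒m<n∨m≡n (≤-pred i<1+m)
  ... | inj₁ i<m = above i i<m p≤i
  ... | inj₂ refl = up p i p≤i (n<1+n i) (above p p<m ≤-refl)
...   | inj₂ refl with Q? p
...     | yes q = p , n≤1+n p , (λ i _ i<p → below i i<p i<p) , above′
  where
  above′ : ∀ i → i < suc p → p ≤ i → Q i
  above′ i i<1+p p≤i rewrite ≤-antisym (≤-pred i<1+p) p≤i = q
...     | no ¬q = suc p , ≤-refl , below′ , (λ i i<1+p 1+p≤i → ⊥-elim (<⇒≱ i<1+p 1+p≤i))
  where
  below′ : ∀ i → i < suc p → i < suc p → ¬ Q i
  below′ i i<1+p _ with m≤n⇒m<n∨m≡n (≤-pred i<1+p)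
  ... | inj₁ i<p = below i i<p i<p
  ... | inj₂ refl = ¬q

argmax : (s : ℕ → ℕ) (n : ℕ) → 0 < n → Σ ℕ λ M → M < n × (∀ i → i < n → s i ≤ s M)
argmax s (suc zero) _ = 0 , s≤s z≤n , λ { zero _ → ≤-refl ; (suc i) (s≤s ()) }
argmax s (suc (suc n)) _ with argmax s (suc n) (s≤s z≤n)
... | M , M<n , max with s (suc n) ≤? s M
...   | yes le = M , <-trans M<n (n<1+n _) , λ i i<n → cases i<n
  where
  cases : ∀ {i} → i < suc (suc n) → s i ≤ s M
  cases {i} (s≤s i≤) with m≤n⇒m<n∨m≡n i≤
  ... | inj₁ lt = max i lt
  ... | inj₂ refl = le
...   | no gt = suc n , ≤-refl , λ i i<n → cases i<n
  where
  cases : ∀ {i} → i < suc (suc n) → s i ≤ s (suc n)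
  cases {i} (s≤s i≤) with m≤n⇒m<n∨m≡n i≤
  ... | inj₁ lt = ≤-trans (max i lt) (<⇒≤ (≰⇒> gt))
  ... | inj₂ refl = ≤-refl

module Reversal (n : ℕ) where

  rev : ℕ → ℕ
  rev x = n ∸ suc x

  rev+ : ∀ x → x < n → rev x + suc x ≡ n
  rev+ x x<n = m∸n+n≡m x<n

  rev<n : 0 < n → ∀ x → rev x < n
  rev<n 0<n x = shrinks n 0<n
    where
    shrinks : ∀ m → 0 < m → m ∸ suc x < m
    shrinks (suc m) _ = s≤s (m∸n≤m m x)

  +suc≡⇒rev : ∀ {v x} → x < n → v + suc x ≡ n → v ≡ rev x
  +suc≡⇒rev {v} {x} x<n e = +-cancelʳ-≡ (suc x) v (rev x) (trans e (sym (rev+ x x<n)))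

  rev-injective : ∀ x y → x < n → y < n → rev x ≡ rev y → x ≡ y
  rev-injective x y x<n y<n e =
    suc-injective (+-cancelˡ-≡ (rev x) _ _ (trans (rev+ x x<n) (trans (sym (rev+ y y<n)) (cong (_+ suc y) (sym e)))))

  rev-< : ∀ x y → x < y → y < n → rev y < rev x
  rev-< x y x<y y<n = +≡+⇒< (trans (rev+ x (<-trans x<y y<n)) (sym (rev+ y y<n))) (s≤s x<y)

  rev-<⁻ : ∀ x y → x < n → y < n → rev x < rev y → y < x
  rev-<⁻ x y x<n y<n lt with <-cmp x y
  ... | tri< x<y _ _ = ⊥-elim (<-asym lt (rev-< x y x<y y<n))
  ... | tri≈ _ refl _ = ⊥-elim (<-irrefl refl lt)
  ... | tri> _ _ y<x = y<x

  rev0≢ : ∀ t → suc t < n → rev 0 ≢ t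
  rev0≢ t 1+t<n e = <-irrefl (trans (sym (+-comm t 1)) (trans (cong (_+ 1) (sym e)) (rev+ 0 (≤-<-trans z≤n 1+t<n)))) 1+t<n

  rev-involutive : ∀ v → v < n → rev (rev v) ≡ v
  rev-involutive v v<n = sym (+suc≡⇒rev (rev<n (≤-<-trans z≤n v<n) v)
    (trans (+-suc v (rev v)) (trans (cong suc (+-comm v (rev v))) (trans (sym (+-suc (rev v) v)) (rev+ v v<n)))))

record Parametrization (τ : List Pattern) (n : ℕ) : Set where
  field
    perm : ℕ → ℕ → ℕ
    perm-< : ∀ t i → i < n → perm t i < n
    perm-injective : ∀ t i j → t < n → i < n → j < n → perm t i ≡ perm t j → i ≡ j
    perm-avoids : ∀ t → t < n → (σ : Fin n → Fin n) → IsPerm σ → σ ≗ℕ perm t → Avoids τ σ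
    classify : (σ : Fin n → Fin n) → IsPerm σ → Avoids τ σ → Σ ℕ λ t → t < n × σ ≗ℕ perm t
    perm-distinct : ∀ t t′ → t < t′ → t′ < n → Σ ℕ λ i → i < n × perm t i ≢ perm t′ i

module Enumeration (d c r : ℕ) where

  n R C : ℕ
  n = d + c + r
  R = d + r
  C = d + c

  open Restriction {n} {R} {C} (rowsFit d c r) (colsFit d c r) public
  open Reversal n public

  R≤n : R ≤ n
  R≤n = rowsFit d c r

  rev-dot : ∀ x → x < n → r ≤ x → rev x < C
  rev-dot x x<n r≤x = +-cancelʳ-< (suc x) (rev x) C (subst (_< C + suc x) (sym (rev+ x x<n)) (+-monoʳ-< C (s≤s r≤x)))

  rev-noDot : ∀ x → x < r → C ≤ rev x
  rev-noDot x x<r = +≡+⇒≤ (rev+ x (<-≤-trans x<r (m≤n+m r C))) x<r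

  inS : ∀ σ → IsPerm σ → dots[ 0 , R ⟩ ⟦ σ ⟧ ≡ d → InS d c r (restrict σ)
  inS σ perm dots = partial , total , emptyRows , emptyCols
    where
    M = restrict σ
    partial = restrict-isPartialPerm σ perm
    total : Vec.sum (Vec.map ones M) ≡ d
    total = trans (∑-ones-restrict σ) dots
    emptyRows : zerosCount (λ i → ones (row M i)) ≡ r
    emptyRows = +-cancelʳ-≡ d _ _ (trans (cong (zerosCount (λ i → ones (row M i)) +_) (sym (trans (sym (∑-ones-rows M)) total)))
                  (trans (zerosCount+sum (λ i → ones (row M i)) (proj₁ partial)) (+-comm d r)))
    emptyCols : zerosCount (λ j → ones (col M j)) ≡ c
    emptyCols = +-cancelʳ-≡ d _ _ (trans (cong (zerosCount (λ j → ones (col M j)) +_) (sym (trans (∑-ones-cols M) total)))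
                  (trans (zerosCount+sum (λ j → ones (col M j)) (proj₂ partial)) (+-comm d c)))

  module _ {τ : List Pattern} (P : Parametrization τ n) where
    open Parametrization P

    permFin : ℕ → Fin n → Fin n
    permFin t x = fromℕ< (perm-< t (toℕ x) (toℕ<n x))

    ⟦permFin⟧ : ∀ t → permFin t ≗ℕ perm t
    ⟦permFin⟧ t i i<n = trans (cong ⟦ permFin t ⟧ (sym (toℕ-fromℕ< i<n)))
      (trans (⟦⟧-toℕ (permFin t) (fromℕ< i<n)) (trans (toℕ-fromℕ< _) (cong (perm t) (toℕ-fromℕ< i<n))))

    permFin-isPerm : ∀ t → t < n → IsPerm (permFin t)
    permFin-isPerm t t<n {x} {y} e = toℕ-injective (perm-injective t (toℕ x) (toℕ y) t<n (toℕ<n x) (toℕ<n y)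
      (trans (sym (toℕ-fromℕ< _)) (trans (cong toℕ e) (toℕ-fromℕ< _))))

    corner : ℕ → Matrix R C
    corner t = restrict (permFin t)

    -- The corners of perm t for lo ≤ t < lo + N are the N distinct elements of S_{d,c,r}(τ).
    record Representatives (lo N : ℕ) : Set where
      field
        within : lo + N ≤ n
        dots : ∀ t → lo ≤ t → t < lo + N → dots[ 0 , R ⟩ (perm t) ≡ d
        separated : ∀ t t′ → lo ≤ t → t < t′ → t′ < lo + N →
                    Σ ℕ λ i → i < R × (perm t′ i < C ⊎ perm t i < C) × perm t i ≢ perm t′ i
        complete : ∀ t → t < n → dots[ 0 , R ⟩ (perm t) ≡ d →
                   Σ ℕ λ t′ → lo ≤ t′ × t′ < lo + N × AgreeOnDots (perm t) (perm t′)

    module _ {lo N : ℕ} (reps : Representatives lo N) where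
      open Representatives reps

      onRows : ∀ (σ : Fin n → Fin n) t → σ ≗ℕ perm t → ∀ i → i < R → ⟦ σ ⟧ i ≡ perm t i
      onRows σ t agree i i<R = agree i (<-≤-trans i<R R≤n)

      ⟦corner⟧ : ∀ t i → i < R → ⟦ permFin t ⟧ i ≡ perm t i
      ⟦corner⟧ t = onRows (permFin t) t (⟦permFin⟧ t)

      corner-≢ : ∀ t t′ → lo ≤ t → t < t′ → t′ < lo + N → corner t ≢ corner t′
      corner-≢ t t′ lo≤t t<t′ t′<N with separated t t′ lo≤t t<t′ t′<N
      ... | i , i<R , inj₁ dot′ , ≢ = ≢-sym (restrict-≢ (permFin t′) (permFin t) i i<R
              (subst (_< C) (sym (⟦corner⟧ t′ i i<R)) dot′)
              (λ e → ≢ (sym (trans (sym (⟦corner⟧ t′ i i<R)) (trans e (⟦corner⟧ t i i<R))))))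
      ... | i , i<R , inj₂ dot , ≢ = restrict-≢ (permFin t) (permFin t′) i i<R
              (subst (_< C) (sym (⟦corner⟧ t i i<R)) dot)
              (λ e → ≢ (trans (sym (⟦corner⟧ t i i<R)) (trans e (⟦corner⟧ t′ i i<R))))

      listing : List (Matrix R C)
      listing = applyUpTo (λ k → corner (lo + k)) N

      listing-unique : Unique listing
      listing-unique = applyUpTo⁺₁ _ N (λ {k} {k′} k<k′ k′<N →
        corner-≢ (lo + k) (lo + k′) (m≤m+n lo k) (+-monoʳ-< lo k<k′) (+-monoʳ-< lo k′<N))

      dots-agree : ∀ (σ : Fin n → Fin n) t → σ ≗ℕ perm t → dots[ 0 , R ⟩ ⟦ σ ⟧ ≡ dots[ 0 , R ⟩ (perm t)
      dots-agree σ t agree = dotsIn-cong ⟦ σ ⟧ (perm t) 0 R (λ i _ i<R → onRows σ t agree i i<R)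

      listed⇒inSτ : ∀ ρ → ρ ∈ listing → InSτ τ d c r ρ
      listed⇒inSτ ρ ρ∈ with ∈-applyUpTo⁻ (λ k → corner (lo + k)) ρ∈
      ... | k , k<N , refl =
        inS (permFin t) (permFin-isPerm t t<n) (trans (dots-agree (permFin t) t (⟦permFin⟧ t)) (dots t (m≤m+n lo k) t<lo+N)) ,
        permFin t , permFin-isPerm t t<n , restrict-extends (permFin t) , perm-avoids t t<n (permFin t) (permFin-isPerm t t<n) (⟦permFin⟧ t)
        where
        t = lo + k
        t<lo+N = +-monoʳ-< lo k<N
        t<n = <-≤-trans t<lo+N within

      inSτ⇒listed : ∀ ρ → InSτ τ d c r ρ → ρ ∈ listing
      inSτ⇒listed ρ ((_ , total , _) , σ , perm , ext , avoids) with classify σ perm avoids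
      ... | t , t<n , agree with complete t t<n (trans (sym (dots-agree σ t agree)) σdots)
        where
        ρ≡ = extends⇒≡restrict ρ σ ext
        σdots : dots[ 0 , R ⟩ ⟦ σ ⟧ ≡ d
        σdots = trans (sym (∑-ones-restrict σ)) (trans (cong (λ M → Vec.sum (Vec.map ones M)) (sym ρ≡)) total)
      ... | t′ , lo≤t′ , t′<lo+N , sameDots =
        subst (_∈ listing) (sym (trans (extends⇒≡restrict ρ σ ext) (restrict-cong σ (permFin t′) σ≈t′)))
          (subst (λ u → corner u ∈ listing) (m+[n∸m]≡n lo≤t′)
            (∈-applyUpTo⁺ (λ k → corner (lo + k)) (+-cancelˡ-< lo _ N (subst (_< lo + N) (sym (m+[n∸m]≡n lo≤t′)) t′<lo+N))))
        where
        σ≈t′ : AgreeOnDots ⟦ σ ⟧ ⟦ permFin t′ ⟧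
        σ≈t′ i i<R with sameDots i i<R
        ... | inj₁ e = inj₁ (trans (onRows σ t agree i i<R) (trans e (sym (⟦corner⟧ t′ i i<R))))
        ... | inj₂ (C≤ , C≤′) =
          inj₂ (subst (C ≤_) (sym (onRows σ t agree i i<R)) C≤ , subst (C ≤_) (sym (⟦corner⟧ t′ i i<R)) C≤′)

      hasCard : HasCard (InSτ τ d c r) N
      hasCard = listing , listing-unique , length-applyUpTo _ N , λ ρ → mk⇔ (listed⇒inSτ ρ) (inSτ⇒listed ρ)

fullCorner : ∀ {τ} d → Parametrization τ (d + 0 + 0) → HasCard (InSτ τ d 0 0) d
fullCorner {τ} d P = hasCard P reps
  where
  open Enumeration d 0 0
  open Parametrization P
  n≡R : n ≡ R
  n≡R = +-identityʳ (d + 0)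
  n≡d : n ≡ d
  n≡d = trans n≡R (+-identityʳ d)
  perm-<R : ∀ t i → i < R → perm t i < C
  perm-<R t i i<R = subst (perm t i <_) n≡R (perm-< t i (subst (i <_) (sym n≡R) i<R))
  reps : Representatives P 0 d
  reps = record
    { within = ≤-reflexive (sym n≡d)
    ; dots = λ t _ _ → trans (dots-all (perm t) 0 R z≤n (λ i _ i<R → perm-<R t i i<R)) (+-identityʳ d)
    ; separated = λ t t′ _ t<t′ t′<d → let i , i<n , ≢ = perm-distinct t t′ t<t′ (subst (t′ <_) (sym n≡d) t′<d)
                                      in i , subst (i <_) n≡R i<n , inj₁ (subst (perm t′ i <_) n≡R (perm-< t′ i i<n)) , ≢
    ; complete = λ t t<n _ → t , z≤n , subst (t <_) n≡d t<n , (λ _ _ → inj₁ refl)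
    }

-- Avoiders of {123, 132, 231}: a decreasing permutation whose value rev t has been moved to the end

module Avoiders₁ (n : ℕ) (0<n : 0 < n) where
  open Reversal n

  m : ℕ
  m = n ∸ 1

  1+m≡n : suc m ≡ n
  1+m≡n = trans (+-comm 1 m) (m∸n+n≡m 0<n)

  m<n : m < n
  m<n = subst (m <_) 1+m≡n (n<1+n m)

  i<m⇒1+i<n : ∀ {i} → i < m → suc i < n
  i<m⇒1+i<n i<m = subst (_ <_) 1+m≡n (s≤s i<m)

  last-unique : ∀ {i j} → i < n → j < n → n ≤ suc i → n ≤ suc j → i ≡ j
  last-unique i<n j<n n≤1+i n≤1+j = suc-injective (trans (≤-antisym i<n n≤1+i) (sym (≤-antisym j<n n≤1+j)))

  rank : ℕ → ℕ → ℕ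
  rank t i with i <? t
  ... | yes _ = i
  ... | no _ with suc i <? n
  ...   | yes _ = suc i
  ...   | no _ = t

  data RankView (t i : ℕ) : Set where
    before : i < t → rank t i ≡ i → RankView t i
    after : t ≤ i → suc i < n → rank t i ≡ suc i → RankView t i
    last : t ≤ i → n ≤ suc i → rank t i ≡ t → RankView t i

  rank-before : ∀ t i → i < t → rank t i ≡ i
  rank-before t i i<t with i <? t
  ... | yes _ = refl
  ... | no i≮t = contradiction i<t i≮t

  rank-after : ∀ t i → t ≤ i → suc i < n → rank t i ≡ suc i
  rank-after t i t≤i 1+i<n with i <? t
  ... | yes i<t = ⊥-elim (<⇒≱ i<t t≤i)
  ... | no _ with suc i <? n
  ...   | yes _ = refl
  ...   | no ≮ = contradiction 1+i<n ≮

  rank-last : ∀ t i → t ≤ i → n ≤ suc i → rank t i ≡ t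
  rank-last t i t≤i n≤1+i with i <? t
  ... | yes i<t = ⊥-elim (<⇒≱ i<t t≤i)
  ... | no _ with suc i <? n
  ...   | yes 1+i<n = ⊥-elim (<⇒≱ 1+i<n n≤1+i)
  ...   | no _ = refl

  rankView : ∀ t i → RankView t i
  rankView t i with i <? t
  ... | yes i<t = before i<t (rank-before t i i<t)
  ... | no i≮t with suc i <? n
  ...   | yes 1+i<n = after (≮⇒≥ i≮t) 1+i<n (rank-after t i (≮⇒≥ i≮t) 1+i<n)
  ...   | no ≮ = last (≮⇒≥ i≮t) (≮⇒≥ ≮) (rank-last t i (≮⇒≥ i≮t) (≮⇒≥ ≮))

  rank-< : ∀ t i → t < n → i < n → rank t i < n
  rank-< t i t<n i<n with rankView t i
  ... | before _ e = subst (_< n) (sym e) i<n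
  ... | after _ 1+i<n e = subst (_< n) (sym e) 1+i<n
  ... | last _ _ e = subst (_< n) (sym e) t<n

  rank-injective : ∀ t i j → i < n → j < n → rank t i ≡ rank t j → i ≡ j
  rank-injective t i j i<n j<n e with rankView t i | rankView t j
  ... | before _ e₁ | before _ e₂ = trans (sym e₁) (trans e e₂)
  ... | before i<t e₁ | after t≤j _ e₂ =
    ⊥-elim (<-irrefl (trans (sym e₁) (trans e e₂)) (<-≤-trans i<t (≤-trans t≤j (n≤1+n j))))
  ... | before i<t e₁ | last _ _ e₂ = ⊥-elim (<-irrefl (trans (sym e₁) (trans e e₂)) i<t)
  ... | after t≤i _ e₁ | before j<t e₂ =
    ⊥-elim (<-irrefl (trans (sym e₂) (trans (sym e) e₁)) (<-≤-trans j<t (≤-trans t≤i (n≤1+n i))))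
  ... | after _ _ e₁ | after _ _ e₂ = suc-injective (trans (sym e₁) (trans e e₂))
  ... | after t≤i _ e₁ | last _ _ e₂ = ⊥-elim (<-irrefl (trans (sym e₂) (trans (sym e) e₁)) (s≤s t≤i))
  ... | last _ _ e₁ | before j<t e₂ = ⊥-elim (<-irrefl (trans (sym e₂) (trans (sym e) e₁)) j<t)
  ... | last _ _ e₁ | after t≤j _ e₂ = ⊥-elim (<-irrefl (trans (sym e₁) (trans e e₂)) (s≤s t≤j))
  ... | last _ n≤1+i _ | last _ n≤1+j _ = last-unique i<n j<n n≤1+i n≤1+j

  rank-increasing : ∀ t i j → i < j → suc j < n → rank t i < rank t j
  rank-increasing t i j i<j 1+j<n with rankView t i | rankView t j
  ... | before _ e₁ | before _ e₂ = subst₂ _<_ (sym e₁) (sym e₂) i<j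
  ... | before _ e₁ | after _ _ e₂ = subst₂ _<_ (sym e₁) (sym e₂) (<-trans i<j (n<1+n j))
  ... | after t≤i _ _ | before j<t _ = ⊥-elim (<⇒≱ j<t (≤-trans t≤i (<⇒≤ i<j)))
  ... | after _ _ e₁ | after _ _ e₂ = subst₂ _<_ (sym e₁) (sym e₂) (s≤s i<j)
  ... | _ | last _ n≤1+j _ = ⊥-elim (<⇒≱ 1+j<n n≤1+j)
  ... | last _ n≤1+i _ | _ = ⊥-elim (<⇒≱ (<-trans (s≤s i<j) 1+j<n) n≤1+i)

  perm : ℕ → ℕ → ℕ
  perm t i = rev (rank t i)

  perm-before : ∀ t i → i < t → perm t i ≡ rev i
  perm-before t i i<t = cong rev (rank-before t i i<t)

  perm-after : ∀ t i → t ≤ i → suc i < n → perm t i ≡ rev (suc i)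
  perm-after t i t≤i 1+i<n = cong rev (rank-after t i t≤i 1+i<n)

  perm-last : ∀ t → t ≤ m → perm t m ≡ rev t
  perm-last t t≤m = cong rev (rank-last t m t≤m (≤-reflexive (sym 1+m≡n)))

  perm-avoids : ∀ t → t < n → (σ : Fin n → Fin n) → IsPerm σ → σ ≗ℕ perm t → Avoids τ₁ σ
  perm-avoids t t<n σ inj agree = no123 ∷ no132 ∷ no231 ∷ []
    where
    noAscent : ∀ i j → i < j → suc j < n → ¬ (⟦ σ ⟧ i < ⟦ σ ⟧ j)
    noAscent i j i<j 1+j<n lt = <⇒≱ (rank-increasing t i j i<j 1+j<n)
      (<⇒≤ (rev-<⁻ (rank t i) (rank t j) (rank-< t i t<n i<n) (rank-< t j t<n j<n) (subst₂ _<_ (agree i i<n) (agree j j<n) lt)))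
      where
      j<n = <-trans (n<1+n j) 1+j<n
      i<n = <-trans i<j j<n
    no123 : ¬ Contains σ (patFun p123)
    no123 c with contains⇒occurrence inverse₁₂₃ σ inj c
    ... | i , j , k , (i<j , j<k , k<n) , i↗j , _ = noAscent i j i<j (≤-<-trans j<k k<n) i↗j
    no132 : ¬ Contains σ (patFun p132)
    no132 c with contains⇒occurrence inverse₁₃₂ σ inj c
    ... | i , j , k , (i<j , j<k , k<n) , i↗k , k↗j = noAscent i j i<j (≤-<-trans j<k k<n) (<-trans i↗k k↗j)
    no231 : ¬ Contains σ (patFun p231)
    no231 c with contains⇒occurrence inverse₂₃₁ σ inj c
    ... | i , j , k , (i<j , j<k , k<n) , _ , i↗j = noAscent i j i<j (≤-<-trans j<k k<n) i↗j

  -- σ descends on [0, m); its value at i is either rev i or, once shifted, rev (suc i).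
  module Classification (σ : Fin n → Fin n) (inj : IsPerm σ)
    (¬123 : ¬ Contains σ (patFun p123)) (¬132 : ¬ Contains σ (patFun p132)) (¬231 : ¬ Contains σ (patFun p231)) where

    s : ℕ → ℕ
    s = ⟦ σ ⟧

    descends : DescendsOn s 0 m
    descends i _ 1+i<m with ⟦⟧-<⊎> σ inj (suc i) i 1+i<n i<n (1+n≢n)
      where
      1+i<n = <-trans 1+i<m m<n
      i<n = <-trans (n<1+n i) 1+i<n
    ... | inj₁ down = down
    ... | inj₂ up with ⟦⟧-<⊎> σ inj (suc i) m (<-trans 1+i<m m<n) m<n (<⇒≢ 1+i<m)
    ...   | inj₁ mid<last =
                ⊥-elim (¬123 (occurrence⇒contains inverse₁₂₃ σ inj (i , suc i , m , (n<1+n i , 1+i<m , m<n) , up , mid<last)))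
    ...   | inj₂ last<mid with ⟦⟧-<⊎> σ inj i m (<-trans (<-trans (n<1+n i) 1+i<m) m<n) m<n (<⇒≢ (<-trans (n<1+n i) 1+i<m))
    ...     | inj₁ first<last =
                ⊥-elim (¬132 (occurrence⇒contains inverse₁₃₂ σ inj (i , suc i , m , (n<1+n i , 1+i<m , m<n) , first<last , last<mid)))
    ...     | inj₂ last<first =
                ⊥-elim (¬231 (occurrence⇒contains inverse₂₃₁ σ inj (i , suc i , m , (n<1+n i , 1+i<m , m<n) , last<first , up)))

    upper : ∀ i → i < m → s i + suc i ≤ n
    upper i i<m = subst (_≤ n) (sym (+-suc (s i) i))
      (≤-<-trans (descent′ s descends 0 i z≤n z≤n i<m) (⟦⟧-< σ 0 (≤-<-trans z≤n m<n)))

    lower : ∀ i → i < m → n ≤ s i + suc (suc i)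
    lower i i<m with m≤n⇒∃[o]m+o≡n i<m
    ... | k , 1+i+k≡m = subst (_≤ s i + suc (suc i)) (trans (sym (reorder i k)) (trans (cong suc 1+i+k≡m) 1+m≡n))
          (+-monoˡ-≤ (suc (suc i)) (≤-trans (m≤n+m k _) (descent s descends i k z≤n (≤-reflexive 1+i+k≡m))))
      where
      reorder : ∀ i k → suc (suc (i + k)) ≡ k + suc (suc i)
      reorder = solve-∀

    Shifted : ℕ → Set
    Shifted i = s i + suc (suc i) ≡ n

    unshifted-value : ∀ i → i < m → ¬ Shifted i → s i + suc i ≡ n
    unshifted-value i i<m ¬shifted with m≤n⇒m<n∨m≡n (upper i i<m)
    ... | inj₂ e = e
    ... | inj₁ lt = ⊥-elim (¬shifted (≤-antisym (subst (_≤ n) (sym (+-suc (s i) (suc i))) lt) (lower i i<m)))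

    shifted-upward : ∀ i j → i ≤ j → j < m → Shifted i → Shifted j
    shifted-upward i j i≤j j<m shifted = ≤-antisym below (lower j j<m)
      where
      reorder : ∀ a i k → a + suc (suc (i + k)) ≡ a + k + suc (suc i)
      reorder = solve-∀
      below : s j + suc (suc j) ≤ n
      below = begin
        s j + suc (suc j)               ≡⟨ cong (λ z → s j + suc (suc z)) (sym (m+[n∸m]≡n i≤j)) ⟩
        s j + suc (suc (i + (j ∸ i)))   ≡⟨ reorder (s j) i (j ∸ i) ⟩
        s j + (j ∸ i) + suc (suc i)     ≤⟨ +-monoˡ-≤ (suc (suc i)) (descent′ s descends i j z≤n i≤j j<m) ⟩
        s i + suc (suc i)               ≡⟨ shifted ⟩
        n                               ∎
        where open ≤-Reasoning

    module Shape (p : ℕ) (p≤m : p ≤ m)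
      (unshifted : ∀ i → i < m → i < p → ¬ Shifted i) (shifted : ∀ i → i < m → p ≤ i → Shifted i) where

      value-before : ∀ i → i < p → s i ≡ rev i
      value-before i i<p = +suc≡⇒rev (<-trans i<m m<n) (unshifted-value i i<m (unshifted i i<m i<p))
        where i<m = <-≤-trans i<p p≤m

      value-after : ∀ i → i < m → p ≤ i → s i ≡ rev (suc i)
      value-after i i<m p≤i = +suc≡⇒rev (i<m⇒1+i<n i<m) (shifted i i<m p≤i)

      -- The missing value rev p must be taken at the last position.
      value-last : s m ≡ rev p
      value-last = at (rev (s m)) (rev<n 0<n (s m)) (rev-involutive (s m) (⟦⟧-< σ m m<n))
        where
        at : ∀ y → y < n → rev y ≡ s m → s m ≡ rev p
        at y y<n rev-y with <-cmp y p
        ... | tri< y<p _ _ = ⊥-elim (<-irrefl (⟦⟧-injective σ inj y m y<n m<n (trans (value-before y y<p) rev-y)) (<-≤-trans y<p p≤m))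
        ... | tri≈ _ refl _ = sym rev-y
        at (suc y) 1+y<n rev-y | tri> _ _ p<1+y =
          ⊥-elim (<-irrefl (⟦⟧-injective σ inj y m (<-trans y<m m<n) m<n (trans (value-after y y<m (≤-pred p<1+y)) rev-y)) y<m)
          where
          y<m = ≤-pred (subst (suc y <_) (sym 1+m≡n) 1+y<n)

      value : ∀ i → i < n → s i ≡ perm p i
      value i i<n with rankView p i
      ... | before i<p e = trans (value-before i i<p) (cong rev (sym e))
      ... | after p≤i 1+i<n e = trans (value-after i (≤-pred (subst (suc i <_) (sym 1+m≡n) 1+i<n)) p≤i) (cong rev (sym e))
      ... | last _ n≤1+i e =
        trans (cong s (last-unique i<n m<n n≤1+i (≤-reflexive (sym 1+m≡n)))) (trans value-last (cong rev (sym e)))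

  classify : (σ : Fin n → Fin n) → IsPerm σ → Avoids τ₁ σ → Σ ℕ λ t → t < n × σ ≗ℕ perm t
  classify σ inj (¬123 ∷ ¬132 ∷ ¬231 ∷ []) with threshold Shifted (λ i → ⟦ σ ⟧ i + suc (suc i) ≟ n) m shifted-upward
    where open Classification σ inj ¬123 ¬132 ¬231
  ... | p , p≤m , unshifted , shifted = p , ≤-<-trans p≤m m<n , Shape.value p p≤m unshifted shifted
    where open Classification σ inj ¬123 ¬132 ¬231

  parametrization : Parametrization τ₁ n
  parametrization = record
    { perm = perm
    ; perm-< = λ t i _ → rev<n 0<n (rank t i)
    ; perm-injective = λ t i j t<n i<n j<n e → rank-injective t i j i<n j<n (rev-injective _ _ (rank-< t i t<n i<n) (rank-< t j t<n j<n) e)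
    ; perm-avoids = perm-avoids
    ; classify = classify
    ; perm-distinct = λ t t′ t<t′ t′<n → t , <-trans t<t′ t′<n , λ e →
        1+n≢n (rev-injective (suc t) t (≤-<-trans t<t′ t′<n) (<-trans t<t′ t′<n)
                (trans (sym (perm-after t t ≤-refl (≤-<-trans t<t′ t′<n))) (trans e (perm-before t′ t t<t′))))
    }

module Corners₁ (d c r : ℕ) (0<n : 0 < d + c + r) where
  open Enumeration d c r
  open Avoiders₁ n 0<n

  noDot-before : ∀ t i → i < t → i < r → C ≤ perm t i
  noDot-before t i i<t i<r = subst (C ≤_) (sym (perm-before t i i<t)) (rev-noDot i i<r)

  -- With columns to spare, the representatives are r ≤ t ≤ R: smaller t carry one dot too many, larger t give the corner of R.
  module SpareColumns (0<c : 0 < c) where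
    R<n : R < n
    R<n = +-monoˡ-< r (m<m+n d 0<c)

    r≤R : r ≤ R
    r≤R = m≤n+m r d

    r+1+d≡1+R : r + suc d ≡ suc R
    r+1+d≡1+R = trans (+-suc r d) (cong suc (+-comm r d))

    dot-after : ∀ t i → t ≤ i → i < R → r ≤ suc i → perm t i < C
    dot-after t i t≤i i<R r≤1+i =
      subst (_< C) (sym (perm-after t i t≤i (≤-<-trans i<R R<n))) (rev-dot (suc i) (≤-<-trans i<R R<n) r≤1+i)

    dots-from-r : ∀ t → r ≤ t → dots[ 0 , R ⟩ (perm t) ≡ d
    dots-from-r t r≤t = begin
        dots[ 0 , R ⟩ (perm t)                          ≡⟨ dots-split (perm t) 0 r R z≤n r≤R ⟩
        dots[ 0 , r ⟩ (perm t) + dots[ r , R ⟩ (perm t)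
          ≡⟨ cong₂ _+_ (dots-none (perm t) 0 r z≤n none) (dots-all (perm t) r R r≤R all) ⟩
        R ∸ r                                          ≡⟨ m+n∸n≡m d r ⟩
        d                                              ∎
      where
      open ≡-Reasoning
      none : ∀ i → 0 ≤ i → i < r → C ≤ perm t i
      none i _ i<r = noDot-before t i (<-≤-trans i<r r≤t) i<r
      all : ∀ i → r ≤ i → i < R → perm t i < C
      all i r≤i i<R with <-≤-connex i t
      ... | inj₁ i<t = subst (_< C) (sym (perm-before t i i<t)) (rev-dot i (<-trans i<R R<n) r≤i)
      ... | inj₂ t≤i = dot-after t i t≤i i<R (≤-trans r≤i (n≤1+n i))

    dots-before-r : ∀ t → t < r → dots[ 0 , R ⟩ (perm t) ≡ suc d
    dots-before-r t t<r = begin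
        dots[ 0 , R ⟩ (perm t)                            ≡⟨ dots-split (perm t) 0 r′ R z≤n r′≤R ⟩
        dots[ 0 , r′ ⟩ (perm t) + dots[ r′ , R ⟩ (perm t)
          ≡⟨ cong₂ _+_ (dots-none (perm t) 0 r′ z≤n none) (dots-all (perm t) r′ R r′≤R all) ⟩
        R ∸ r′                                           ≡⟨ cong (λ z → d + z ∸ r′) (sym 1+r′≡r) ⟩
        d + suc r′ ∸ r′                                  ≡⟨ cong (_∸ r′) (+-suc d r′) ⟩
        suc (d + r′) ∸ r′                                ≡⟨ +-∸-assoc 1 (m≤n+m r′ d) ⟩
        suc (d + r′ ∸ r′)                                ≡⟨ cong suc (m+n∸n≡m d r′) ⟩
        suc d                                          ∎
      where
      open ≡-Reasoning
      r′ = r ∸ 1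
      1+r′≡r : suc r′ ≡ r
      1+r′≡r = trans (+-comm 1 r′) (m∸n+n≡m (≤-trans (s≤s z≤n) t<r))
      r′≤R : r′ ≤ R
      r′≤R = ≤-trans (m∸n≤m r 1) r≤R
      none : ∀ i → 0 ≤ i → i < r′ → C ≤ perm t i
      none i _ i<r′ with <-≤-connex i t
      ... | inj₁ i<t = noDot-before t i i<t (<-trans i<r′ (subst (r′ <_) 1+r′≡r (n<1+n r′)))
      ... | inj₂ t≤i = subst (C ≤_) (sym (perm-after t i t≤i (≤-<-trans (≤-trans i<r′ r′≤R) R<n)))
                         (rev-noDot (suc i) (subst (suc i <_) 1+r′≡r (s≤s i<r′)))
      all : ∀ i → r′ ≤ i → i < R → perm t i < C
      all i r′≤i i<R =
        dot-after t i (≤-trans (≤-pred (subst (t <_) (sym 1+r′≡r) t<r)) r′≤i) i<R (subst (_≤ suc i) 1+r′≡r (s≤s r′≤i))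

    representatives : Representatives parametrization r (suc d)
    representatives = record
      { within = subst (_≤ n) (sym r+1+d≡1+R) R<n
      ; dots = λ t r≤t _ → dots-from-r t r≤t
      ; separated = separated
      ; complete = complete
      }
      where
      separated : ∀ t t′ → r ≤ t → t < t′ → t′ < r + suc d →
                  Σ ℕ λ i → i < R × (perm t′ i < C ⊎ perm t i < C) × perm t i ≢ perm t′ i
      separated t t′ r≤t t<t′ t′<r+1+d =
        t , t<R , inj₁ (subst (_< C) (sym (perm-before t′ t t<t′)) (rev-dot t (<-trans t<R R<n) r≤t)) ,
        λ e → 1+n≢n (rev-injective (suc t) t 1+t<n (<-trans t<R R<n)
                (trans (sym (perm-after t t ≤-refl 1+t<n)) (trans e (perm-before t′ t t<t′))))
        where
        t<R : t < R
        t<R = <-≤-trans t<t′ (≤-pred (subst (t′ <_) r+1+d≡1+R t′<r+1+d))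
        1+t<n = ≤-<-trans t<R R<n
      complete : ∀ t → t < n → dots[ 0 , R ⟩ (perm t) ≡ d →
                 Σ ℕ λ t′ → r ≤ t′ × t′ < r + suc d × AgreeOnDots (perm t) (perm t′)
      complete t t<n d-dots with <-≤-connex t r | <-≤-connex R t
      ... | inj₁ t<r | _ = ⊥-elim (1+n≢n (trans (sym (dots-before-r t t<r)) d-dots))
      ... | inj₂ r≤t | inj₂ t≤R = t , r≤t , subst (t <_) (sym r+1+d≡1+R) (s≤s t≤R) , (λ _ _ → inj₁ refl)
      ... | inj₂ _ | inj₁ R<t = R , r≤R , subst (R <_) (sym r+1+d≡1+R) ≤-refl ,
              λ i i<R → inj₁ (trans (perm-before t i (<-trans i<R R<t)) (sym (perm-before R i i<R)))

    hasCard₁ : HasCard (InSτ τ₁ d c r) (suc d)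
    hasCard₁ = hasCard parametrization representatives

  -- Without spare columns every row is in the corner; the representatives are r - 1 ≤ t < n.
  module NoSpareColumns (c≡0 : c ≡ 0) (r′ : ℕ) (1+r′≡r : suc r′ ≡ r) where
    n≡R : n ≡ R
    n≡R = trans (cong (λ z → d + z + r) c≡0) (cong (_+ r) (+-identityʳ d))

    m≡d+r′ : m ≡ d + r′
    m≡d+r′ = suc-injective (trans 1+m≡n (trans n≡R (trans (cong (d +_) (sym 1+r′≡r)) (+-suc d r′))))

    r′+1+d≡n : r′ + suc d ≡ n
    r′+1+d≡n = trans (+-suc r′ d) (trans (cong suc (trans (+-comm r′ d) (sym m≡d+r′))) 1+m≡n)

    r′≤m : r′ ≤ m
    r′≤m = subst (r′ ≤_) (sym m≡d+r′) (m≤n+m r′ d)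

    r′<r : r′ < r
    r′<r = subst (r′ <_) 1+r′≡r (n<1+n r′)

    m∸r′≡d : m ∸ r′ ≡ d
    m∸r′≡d = trans (cong (_∸ r′) m≡d+r′) (m+n∸n≡m d r′)

    dots-by-last-row : ∀ t a → a ≤ m →
                       dots[ 0 , R ⟩ (perm t) ≡ dots[ 0 , a ⟩ (perm t) + dots[ a , m ⟩ (perm t) + dots[ m , suc m ⟩ (perm t)
    dots-by-last-row t a a≤m = trans (cong (λ z → dots[ 0 , z ⟩ (perm t)) (trans (sym n≡R) (sym 1+m≡n)))
       (trans (dots-split (perm t) 0 m (suc m) z≤n (n≤1+n m)) (cong (_+ dots[ m , suc m ⟩ (perm t)) (dots-split (perm t) 0 a m z≤n a≤m)))

    dot-after : ∀ t i → t ≤ i → i < m → r ≤ suc i → perm t i < C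
    dot-after t i t≤i i<m r≤1+i = subst (_< C) (sym (perm-after t i t≤i (i<m⇒1+i<n i<m))) (rev-dot (suc i) (i<m⇒1+i<n i<m) r≤1+i)

    dots-at-r′ : dots[ 0 , R ⟩ (perm r′) ≡ d
    dots-at-r′ = begin
        dots[ 0 , R ⟩ (perm r′)
          ≡⟨ dots-by-last-row r′ r′ r′≤m ⟩
        dots[ 0 , r′ ⟩ (perm r′) + dots[ r′ , m ⟩ (perm r′) + dots[ m , suc m ⟩ (perm r′)
          ≡⟨ cong₂ (λ a b → a + b + dots[ m , suc m ⟩ (perm r′))
                   (dots-none (perm r′) 0 r′ z≤n none) (dots-all (perm r′) r′ m r′≤m all) ⟩
        m ∸ r′ + dots[ m , suc m ⟩ (perm r′)
          ≡⟨ cong (m ∸ r′ +_) (dots-zero (perm r′) m (subst (C ≤_) (sym (perm-last r′ r′≤m)) (rev-noDot r′ r′<r))) ⟩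
        m ∸ r′ + 0
          ≡⟨ trans (+-identityʳ _) m∸r′≡d ⟩
        d ∎
      where
      open ≡-Reasoning
      none : ∀ i → 0 ≤ i → i < r′ → C ≤ perm r′ i
      none i _ i<r′ = noDot-before r′ i i<r′ (<-trans i<r′ r′<r)
      all : ∀ i → r′ ≤ i → i < m → perm r′ i < C
      all i r′≤i i<m = dot-after r′ i r′≤i i<m (subst (_≤ suc i) 1+r′≡r (s≤s r′≤i))

    dots-after-r′ : ∀ t → r′ < t → t < n → dots[ 0 , R ⟩ (perm t) ≡ d
    dots-after-r′ t r′<t t<n = begin
        dots[ 0 , R ⟩ (perm t)
          ≡⟨ dots-by-last-row t r r≤m ⟩
        dots[ 0 , r ⟩ (perm t) + dots[ r , m ⟩ (perm t) + dots[ m , suc m ⟩ (perm t)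
          ≡⟨ cong₂ (λ a b → a + b + dots[ m , suc m ⟩ (perm t)) (dots-none (perm t) 0 r z≤n none) (dots-all (perm t) r m r≤m all) ⟩
        m ∸ r + dots[ m , suc m ⟩ (perm t)
          ≡⟨ cong (m ∸ r +_) (dots-one (perm t) m (subst (_< C) (sym (perm-last t t≤m)) (rev-dot t t<n r≤t))) ⟩
        m ∸ r + 1
          ≡⟨ trans (+-comm (m ∸ r) 1) (trans (sym (+-∸-assoc 1 r≤m)) (cong (λ z → suc m ∸ z) (sym 1+r′≡r))) ⟩
        m ∸ r′
          ≡⟨ m∸r′≡d ⟩
        d ∎
      where
      open ≡-Reasoning
      r≤t : r ≤ t
      r≤t = subst (_≤ t) 1+r′≡r r′<t
      t≤m : t ≤ m
      t≤m = ≤-pred (subst (t <_) (sym 1+m≡n) t<n)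
      r≤m : r ≤ m
      r≤m = ≤-trans r≤t t≤m
      none : ∀ i → 0 ≤ i → i < r → C ≤ perm t i
      none i _ i<r = noDot-before t i (<-≤-trans i<r r≤t) i<r
      all : ∀ i → r ≤ i → i < m → perm t i < C
      all i r≤i i<m with <-≤-connex i t
      ... | inj₁ i<t = subst (_< C) (sym (perm-before t i i<t)) (rev-dot i (<-trans i<m m<n) r≤i)
      ... | inj₂ t≤i = dot-after t i t≤i i<m (≤-trans r≤i (n≤1+n i))

    representatives : Representatives parametrization r′ (suc d)
    representatives = record
      { within = ≤-reflexive r′+1+d≡n
      ; dots = dots
      ; separated = separated
      ; complete = complete
      }
      where
      dots : ∀ t → r′ ≤ t → t < r′ + suc d → dots[ 0 , R ⟩ (perm t) ≡ d
      dots t r′≤t t<r′+1+d with m≤n⇒m<n∨m≡n r′≤t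
      ... | inj₁ r′<t = dots-after-r′ t r′<t (subst (t <_) r′+1+d≡n t<r′+1+d)
      ... | inj₂ refl = dots-at-r′
      separated : ∀ t t′ → r′ ≤ t → t < t′ → t′ < r′ + suc d →
                  Σ ℕ λ i → i < R × (perm t′ i < C ⊎ perm t i < C) × perm t i ≢ perm t′ i
      separated t t′ r′≤t t<t′ t′<r′+1+d =
        t , subst (t <_) n≡R t<n ,
        inj₂ (subst (_< C) (sym (perm-after t t ≤-refl 1+t<n)) (rev-dot (suc t) 1+t<n (subst (_≤ suc t) 1+r′≡r (s≤s r′≤t)))) ,
        λ e → 1+n≢n (rev-injective (suc t) t 1+t<n t<n (trans (sym (perm-after t t ≤-refl 1+t<n)) (trans e (perm-before t′ t t<t′))))
        where
        1+t<n = ≤-<-trans t<t′ (subst (t′ <_) r′+1+d≡n t′<r′+1+d)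
        t<n = <-trans (n<1+n t) 1+t<n
      complete : ∀ t → t < n → dots[ 0 , R ⟩ (perm t) ≡ d →
                 Σ ℕ λ t′ → r′ ≤ t′ × t′ < r′ + suc d × AgreeOnDots (perm t) (perm t′)
      complete t t<n _ with <-≤-connex t r′
      ... | inj₂ r′≤t = t , r′≤t , subst (t <_) (sym r′+1+d≡n) t<n , (λ _ _ → inj₁ refl)
      ... | inj₁ t<r′ = r′ , ≤-refl , m<m+n r′ (s≤s z≤n) , sameDots
        where
        sameDots : AgreeOnDots (perm t) (perm r′)
        sameDots i i<R with <-≤-connex i t | <-≤-connex i r′ | <-≤-connex i m
        ... | inj₁ i<t | inj₁ i<r′ | _ = inj₁ (trans (perm-before t i i<t) (sym (perm-before r′ i i<r′)))
        ... | inj₁ i<t | inj₂ r′≤i | _ = ⊥-elim (<⇒≱ (<-trans i<t t<r′) r′≤i)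
        ... | inj₂ t≤i | inj₁ i<r′ | _ =
          inj₂ (subst (C ≤_) (sym (perm-after t i t≤i (≤-<-trans (≤-trans i<r′ r′≤m) m<n)))
                  (rev-noDot (suc i) (subst (suc i <_) 1+r′≡r (s≤s i<r′))) ,
                noDot-before r′ i i<r′ (<-trans i<r′ r′<r))
        ... | inj₂ t≤i | inj₂ r′≤i | inj₁ i<m =
          inj₁ (trans (perm-after t i t≤i (i<m⇒1+i<n i<m)) (sym (perm-after r′ i r′≤i (i<m⇒1+i<n i<m))))
        ... | inj₂ _ | inj₂ _ | inj₂ m≤i = inj₂ (subst (λ z → C ≤ perm t z × C ≤ perm r′ z) m≡i
          (subst (C ≤_) (sym (perm-last t (<⇒≤ (<-≤-trans t<r′ r′≤m)))) (rev-noDot t (<-trans t<r′ r′<r)) ,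
           subst (C ≤_) (sym (perm-last r′ r′≤m)) (rev-noDot r′ r′<r)))
          where
          m≡i = ≤-antisym m≤i (≤-pred (subst (i <_) (trans (sym n≡R) (sym 1+m≡n)) i<R))

    hasCard₁ : HasCard (InSτ τ₁ d c r) (suc d)
    hasCard₁ = hasCard parametrization representatives

-- Avoiders of {123, 132, 312}: the maximum inserted at position t into a decreasing permutation

module Avoiders₂ (n : ℕ) (0<n : 0 < n) where
  open Reversal n
  open Avoiders₁ n 0<n using (m; 1+m≡n; m<n; i<m⇒1+i<n)

  rank : ℕ → ℕ → ℕ
  rank t i with <-cmp i t
  ... | tri< _ _ _ = suc i
  ... | tri≈ _ _ _ = 0
  ... | tri> _ _ _ = i

  rank-before : ∀ t i → i < t → rank t i ≡ suc i
  rank-before t i i<t with <-cmp i t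
  ... | tri< _ _ _ = refl
  ... | tri≈ ¬< _ _ = contradiction i<t ¬<
  ... | tri> ¬< _ _ = contradiction i<t ¬<

  rank-at : ∀ t → rank t t ≡ 0
  rank-at t with <-cmp t t
  ... | tri< _ ¬≡ _ = contradiction refl ¬≡
  ... | tri≈ _ _ _ = refl
  ... | tri> _ ¬≡ _ = contradiction refl ¬≡

  rank-after : ∀ t i → t < i → rank t i ≡ i
  rank-after t i t<i with <-cmp i t
  ... | tri< _ _ ¬> = contradiction t<i ¬>
  ... | tri≈ _ _ ¬> = contradiction t<i ¬>
  ... | tri> _ _ _ = refl

  rank-< : ∀ t i → t < n → i < n → rank t i < n
  rank-< t i t<n i<n with <-cmp i t
  ... | tri< i<t _ _ = ≤-<-trans i<t t<n
  ... | tri≈ _ _ _ = 0<n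
  ... | tri> _ _ _ = i<n

  rank-injective : ∀ t i j → rank t i ≡ rank t j → i ≡ j
  rank-injective t i j e with <-cmp i t | <-cmp j t
  ... | tri< _ _ _ | tri< _ _ _ = suc-injective e
  ... | tri< _ _ _ | tri≈ _ _ _ with () ← e
  ... | tri< i<t _ _ | tri> _ _ t<j = ⊥-elim (<-irrefl e (<-≤-trans (s≤s i<t) t<j))
  ... | tri≈ _ _ _ | tri< _ _ _ with () ← e
  ... | tri≈ _ i≡t _ | tri≈ _ j≡t _ = trans i≡t (sym j≡t)
  ... | tri≈ _ _ _ | tri> _ _ t<j = ⊥-elim (<-irrefl e (≤-<-trans z≤n t<j))
  ... | tri> _ _ t<i | tri< j<t _ _ = ⊥-elim (<-irrefl (sym e) (<-≤-trans (s≤s j<t) t<i))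
  ... | tri> _ _ t<i | tri≈ _ _ _ = ⊥-elim (<-irrefl (sym e) (≤-<-trans z≤n t<i))
  ... | tri> _ _ _ | tri> _ _ _ = e

  rank-drop⇒at : ∀ t i j → i < j → rank t j < rank t i → j ≡ t
  rank-drop⇒at t i j i<j drop with <-cmp i t | <-cmp j t
  ... | _ | tri≈ _ j≡t _ = j≡t
  ... | tri< _ _ _ | tri< _ _ _ = ⊥-elim (<-asym drop (s≤s i<j))
  ... | tri< i<t _ _ | tri> _ _ t<j = ⊥-elim (<⇒≱ drop (<-trans i<t t<j))
  ... | tri≈ _ refl _ | tri< j<t _ _ = ⊥-elim (<-asym i<j j<t)
  ... | tri≈ _ _ _ | tri> _ _ _ = ⊥-elim (n≮0 drop)
  ... | tri> _ _ t<i | tri< j<t _ _ = ⊥-elim (<-asym (<-trans t<i i<j) j<t)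
  ... | tri> _ _ _ | tri> _ _ _ = ⊥-elim (<-asym drop i<j)

  perm : ℕ → ℕ → ℕ
  perm t i = rev (rank t i)

  data Place (t i : ℕ) : Set where
    before : i < t → Place t i
    at : i ≡ t → Place t i
    after : t < i → Place t i

  place : ∀ t i → Place t i
  place t i with <-cmp i t
  ... | tri< i<t _ _ = before i<t
  ... | tri≈ _ i≡t _ = at i≡t
  ... | tri> _ _ t<i = after t<i

  perm-before : ∀ t i → i < t → perm t i ≡ rev (suc i)
  perm-before t i i<t = cong rev (rank-before t i i<t)

  perm-at : ∀ t → perm t t ≡ rev 0
  perm-at t = cong rev (rank-at t)

  perm-after : ∀ t i → t < i → perm t i ≡ rev i
  perm-after t i t<i = cong rev (rank-after t i t<i)

  perm-avoids : ∀ t → t < n → (σ : Fin n → Fin n) → IsPerm σ → σ ≗ℕ perm t → Avoids τ₂ σ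
  perm-avoids t t<n σ inj agree = no123 ∷ no132 ∷ no312 ∷ []
    where
    ascent⇒at : ∀ i j → i < j → j < n → ⟦ σ ⟧ i < ⟦ σ ⟧ j → j ≡ t
    ascent⇒at i j i<j j<n lt = rank-drop⇒at t i j i<j
      (rev-<⁻ (rank t i) (rank t j) (rank-< t i t<n (<-trans i<j j<n)) (rank-< t j t<n j<n)
              (subst₂ _<_ (agree i (<-trans i<j j<n)) (agree j j<n) lt))
    no123 : ¬ Contains σ (patFun p123)
    no123 c with contains⇒occurrence inverse₁₂₃ σ inj c
    ... | i , j , k , (i<j , j<k , k<n) , i↗j , j↗k =
      <-irrefl (trans (ascent⇒at i j i<j (<-trans j<k k<n) i↗j) (sym (ascent⇒at j k j<k k<n j↗k))) j<k
    no132 : ¬ Contains σ (patFun p132)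
    no132 c with contains⇒occurrence inverse₁₃₂ σ inj c
    ... | i , j , k , (i<j , j<k , k<n) , i↗k , k↗j =
      <-irrefl (trans (ascent⇒at i j i<j (<-trans j<k k<n) (<-trans i↗k k↗j)) (sym (ascent⇒at i k (<-trans i<j j<k) k<n i↗k))) j<k
    no312 : ¬ Contains σ (patFun p312)
    no312 c with contains⇒occurrence inverse₃₁₂ σ inj c
    ... | i , j , k , (i<j , j<k , k<n) , j↗k , k↘i with ascent⇒at j k j<k k<n j↗k
    ...   | refl = n≮0 (subst (rank t i <_) (rank-at t)
              (rev-<⁻ (rank t t) (rank t i) (rank-< t t t<n t<n) (rank-< t i t<n i<n) (subst₂ _<_ (agree t k<n) (agree i i<n) k↘i)))
      where i<n = <-trans (<-trans i<j j<k) k<n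

  -- With the maximum at M removed, σ descends, so its values are forced.
  module Classification (σ : Fin n → Fin n) (inj : IsPerm σ)
    (¬123 : ¬ Contains σ (patFun p123)) (¬132 : ¬ Contains σ (patFun p132)) (¬312 : ¬ Contains σ (patFun p312))
    (M : ℕ) (M<n : M < n) (max : ∀ i → i < n → ⟦ σ ⟧ i ≤ ⟦ σ ⟧ M) where

    s : ℕ → ℕ
    s = ⟦ σ ⟧

    below-max : ∀ i → i < n → i ≢ M → s i < s M
    below-max i i<n i≢M = ≤∧≢⇒< (max i i<n) (λ e → i≢M (⟦⟧-injective σ inj i M i<n M<n e))

    skip : ℕ → ℕ
    skip k with <-≤-connex k M
    ... | inj₁ _ = k
    ... | inj₂ _ = suc k

    skip-before : ∀ k → k < M → skip k ≡ k
    skip-before k k<M with <-≤-connex k M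
    ... | inj₁ _ = refl
    ... | inj₂ M≤k = ⊥-elim (<⇒≱ k<M M≤k)

    skip-after : ∀ k → M ≤ k → skip k ≡ suc k
    skip-after k M≤k with <-≤-connex k M
    ... | inj₁ k<M = ⊥-elim (<⇒≱ k<M M≤k)
    ... | inj₂ _ = refl

    u : ℕ → ℕ
    u k = s (skip k)

    descends : DescendsOn u 0 m
    descends k _ 1+k<m with suc k <? M
    ... | yes 1+k<M = subst₂ _<_ (cong s (sym (skip-before (suc k) 1+k<M))) (cong s (sym (skip-before k (<-trans (n<1+n k) 1+k<M)))) down
      where
      1+k<n = <-trans 1+k<m m<n
      down : s (suc k) < s k
      down with ⟦⟧-<⊎> σ inj (suc k) k 1+k<n (<-trans (n<1+n k) 1+k<n) 1+n≢n
      ... | inj₁ d = d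
      ... | inj₂ up = ⊥-elim (¬123 (occurrence⇒contains inverse₁₂₃ σ inj
              (k , suc k , M , (n<1+n k , 1+k<M , M<n) , up , below-max (suc k) 1+k<n (<⇒≢ 1+k<M))))
    ... | no 1+k≮M with ≮⇒≥ 1+k≮M | k <? M
    ...   | M≤1+k | yes k<M = subst₂ _<_ (cong s (sym (skip-after (suc k) M≤1+k))) (cong s (sym (skip-before k k<M))) down
      where
      M≡1+k = ≤-antisym M≤1+k k<M
      2+k<n = i<m⇒1+i<n 1+k<m
      k<2+k = <-trans (n<1+n k) (n<1+n (suc k))
      down : s (suc (suc k)) < s k
      down with ⟦⟧-<⊎> σ inj (suc (suc k)) k 2+k<n (<-trans k<2+k 2+k<n) (≢-sym (<⇒≢ k<2+k))
      ... | inj₁ d = d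
      ... | inj₂ up = ⊥-elim (¬132 (occurrence⇒contains inverse₁₃₂ σ inj
              (k , suc k , suc (suc k) , (n<1+n k , n<1+n (suc k) , 2+k<n) , up ,
               subst (λ z → s (suc (suc k)) < s z) M≡1+k (below-max (suc (suc k)) 2+k<n (λ e → 1+n≢n (trans e M≡1+k))))))
    ...   | M≤1+k | no k≮M = subst₂ _<_ (cong s (sym (skip-after (suc k) M≤1+k))) (cong s (sym (skip-after k M≤k))) down
      where
      M≤k = ≮⇒≥ k≮M
      2+k<n = i<m⇒1+i<n 1+k<m
      down : s (suc (suc k)) < s (suc k)
      down with ⟦⟧-<⊎> σ inj (suc (suc k)) (suc k) 2+k<n (<-trans 1+k<m m<n) 1+n≢n
      ... | inj₁ d = d
      ... | inj₂ up = ⊥-elim (¬312 (occurrence⇒contains inverse₃₁₂ σ inj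
              (M , suc k , suc (suc k) , (s≤s M≤k , n<1+n (suc k) , 2+k<n) , up ,
               below-max (suc (suc k)) 2+k<n (λ e → <-irrefl (sym e) (<-trans (s≤s M≤k) (n<1+n (suc k)))))))

    u0<max : 0 < m → u 0 < s M
    u0<max 0<m with <-≤-connex 0 M
    ... | inj₁ 0<M = below-max 0 (<-trans 0<m m<n) (<⇒≢ 0<M)
    ... | inj₂ M≤0 = below-max 1 (i<m⇒1+i<n 0<m) (λ e → <⇒≱ (s≤s z≤n) (subst (_≤ 0) (sym e) M≤0))

    upper : ∀ k → k < m → u k + suc (suc k) ≤ n
    upper k k<m = begin
        u k + suc (suc k)     ≡⟨ trans (+-suc (u k) (suc k)) (cong suc (+-suc (u k) k)) ⟩
        suc (suc (u k + k))   ≤⟨ s≤s (s≤s (descent′ u descends 0 k z≤n z≤n k<m)) ⟩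
        suc (suc (u 0))       ≤⟨ s≤s (u0<max (≤-<-trans z≤n k<m)) ⟩
        suc (s M)             ≤⟨ ⟦⟧-< σ M M<n ⟩
        n                     ∎
      where open ≤-Reasoning

    lower : ∀ k → k < m → n ≤ u k + suc (suc k)
    lower k k<m with m≤n⇒∃[o]m+o≡n k<m
    ... | j , 1+k+j≡m = subst (_≤ u k + suc (suc k)) (trans (sym (reorder k j)) (trans (cong suc 1+k+j≡m) 1+m≡n))
          (+-monoˡ-≤ (suc (suc k)) (≤-trans (m≤n+m j _) (descent u descends k j z≤n (≤-reflexive 1+k+j≡m))))
      where
      reorder : ∀ i k → suc (suc (i + k)) ≡ k + suc (suc i)
      reorder = solve-∀

    u-value : ∀ k → k < m → u k ≡ rev (suc k)
    u-value k k<m = +suc≡⇒rev (i<m⇒1+i<n k<m) (≤-antisym (upper k k<m) (lower k k<m))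

    max-value : s M ≡ rev 0
    max-value = +suc≡⇒rev 0<n (≤-antisym (subst (_≤ n) (+-comm 1 (s M)) (⟦⟧-< σ M M<n)) n≤)
      where
      n≤ : n ≤ s M + 1
      n≤ with m ≟ 0
      ... | yes m≡0 = subst (_≤ s M + 1) (trans (cong suc (sym m≡0)) 1+m≡n) (m≤n+m 1 (s M))
      ... | no m≢0 = begin
          n                  ≡⟨ sym (≤-antisym (upper 0 0<m) (lower 0 0<m)) ⟩
          u 0 + 2            ≡⟨ +-comm (u 0) 2 ⟩
          suc (suc (u 0))    ≤⟨ s≤s (u0<max 0<m) ⟩
          suc (s M)          ≡⟨ +-comm 1 (s M) ⟩
          s M + 1            ∎
        where
        open ≤-Reasoning
        0<m : 0 < m
        0<m = ≤∧≢⇒< z≤n (≢-sym m≢0)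

    value : ∀ i → i < n → s i ≡ perm M i
    value i i<n with <-≤-connex i M
    ... | inj₁ i<M = trans (cong s (sym (skip-before i i<M))) (trans (u-value i (<-≤-trans i<M M≤m)) (sym (perm-before M i i<M)))
      where M≤m = ≤-pred (subst (M <_) (sym 1+m≡n) M<n)
    ... | inj₂ M≤i with m≤n⇒m<n∨m≡n M≤i
    ...   | inj₂ refl = trans max-value (sym (perm-at M))
    value (suc k) 1+k<n | inj₂ _ | inj₁ M<1+k =
      trans (cong s (sym (skip-after k (≤-pred M<1+k))))
            (trans (u-value k (≤-pred (subst (suc k <_) (sym 1+m≡n) 1+k<n))) (sym (perm-after M (suc k) M<1+k)))

  classify : (σ : Fin n → Fin n) → IsPerm σ → Avoids τ₂ σ → Σ ℕ λ t → t < n × σ ≗ℕ perm t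
  classify σ inj (¬123 ∷ ¬132 ∷ ¬312 ∷ []) with argmax ⟦ σ ⟧ n 0<n
  ... | M , M<n , max = M , M<n , Classification.value σ inj ¬123 ¬132 ¬312 M M<n max

  parametrization : Parametrization τ₂ n
  parametrization = record
    { perm = perm
    ; perm-< = λ t i _ → rev<n 0<n (rank t i)
    ; perm-injective = λ t i j t<n i<n j<n e → rank-injective t i j (rev-injective _ _ (rank-< t i t<n i<n) (rank-< t j t<n j<n) e)
    ; perm-avoids = perm-avoids
    ; classify = classify
    ; perm-distinct = λ t t′ t<t′ t′<n → t , <-trans t<t′ t′<n , λ e →
        0≢1+n (rev-injective 0 (suc t) 0<n (≤-<-trans t<t′ t′<n) (trans (sym (perm-at t)) (trans e (perm-before t′ t t<t′))))
    }

module Corners₂ (d c r : ℕ) (0<n : 0 < d + c + r) where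
  open Enumeration d c r
  open Avoiders₂ n 0<n

  -- With an empty row available, the maximum must sit in one: the representatives are r - 1 ≤ t < R.
  module EmptyRows (r′ : ℕ) (1+r′≡r : suc r′ ≡ r) where
    r′+1+d≡R : r′ + suc d ≡ R
    r′+1+d≡R = trans (+-suc r′ d) (trans (cong suc (+-comm r′ d)) (trans (sym (+-suc d r′)) (cong (d +_) 1+r′≡r)))

    r′≤R : r′ ≤ R
    r′≤R = ≤-trans (m≤n+m r′ d) (subst (d + r′ ≤_) (cong (d +_) 1+r′≡r) (+-monoʳ-≤ d (n≤1+n r′)))

    max-noDot : ∀ t → C ≤ perm t t
    max-noDot t = subst (C ≤_) (sym (perm-at t)) (rev-noDot 0 (subst (0 <_) 1+r′≡r (s≤s z≤n)))

    noDot-before : ∀ t i → i < t → i < r′ → C ≤ perm t i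
    noDot-before t i i<t i<r′ = subst (C ≤_) (sym (perm-before t i i<t)) (rev-noDot (suc i) (subst (suc i <_) 1+r′≡r (s≤s i<r′)))

    dot-before : ∀ t i → i < t → r′ ≤ i → suc i < n → perm t i < C
    dot-before t i i<t r′≤i 1+i<n =
      subst (_< C) (sym (perm-before t i i<t)) (rev-dot (suc i) 1+i<n (subst (_≤ suc i) 1+r′≡r (s≤s r′≤i)))

    dots-inside : ∀ t → r′ ≤ t → t < R → dots[ 0 , R ⟩ (perm t) ≡ d
    dots-inside t r′≤t t<R = begin
        dots[ 0 , R ⟩ (perm t)
          ≡⟨ dots-split (perm t) 0 t R z≤n (<⇒≤ t<R) ⟩
        dots[ 0 , t ⟩ (perm t) + dots[ t , R ⟩ (perm t)
          ≡⟨ cong₂ _+_ (dots-split (perm t) 0 r′ t z≤n r′≤t) (dots-split (perm t) t (suc t) R (n≤1+n t) t<R) ⟩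
        (dots[ 0 , r′ ⟩ (perm t) + dots[ r′ , t ⟩ (perm t)) + (dots[ t , suc t ⟩ (perm t) + dots[ suc t , R ⟩ (perm t))
          ≡⟨ cong₂ _+_ (cong₂ _+_ (dots-none (perm t) 0 r′ z≤n (λ i _ i<r′ → noDot-before t i (<-≤-trans i<r′ r′≤t) i<r′))
                                  (dots-all (perm t) r′ t r′≤t
                                     (λ i r′≤i i<t → dot-before t i i<t r′≤i (<-≤-trans (s≤s i<t) (<-≤-trans t<R R≤n)))))
                       (cong₂ _+_ (dots-zero (perm t) t (max-noDot t)) (dots-all (perm t) (suc t) R t<R dot-after-t)) ⟩
        (t ∸ r′) + (R ∸ suc t)
          ≡⟨ lengths ⟩
        d ∎
      where
      open ≡-Reasoning
      dot-after-t : ∀ i → suc t ≤ i → i < R → perm t i < C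
      dot-after-t i t<i i<R = subst (_< C) (sym (perm-after t i t<i))
        (rev-dot i (<-≤-trans i<R R≤n) (≤-trans (subst (_≤ suc t) 1+r′≡r (s≤s r′≤t)) t<i))
      reorder : ∀ x y z → x + y + suc z ≡ y + suc (x + z)
      reorder = solve-∀
      lengths : (t ∸ r′) + (R ∸ suc t) ≡ d
      lengths = +-cancelʳ-≡ (suc r′) _ d (begin
        (t ∸ r′) + (R ∸ suc t) + suc r′     ≡⟨ reorder (t ∸ r′) (R ∸ suc t) r′ ⟩
        (R ∸ suc t) + suc (t ∸ r′ + r′)     ≡⟨ cong (λ z → (R ∸ suc t) + suc z) (m∸n+n≡m r′≤t) ⟩
        (R ∸ suc t) + suc t                 ≡⟨ m∸n+n≡m t<R ⟩
        R                                   ≡⟨ sym r′+1+d≡R ⟩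
        r′ + suc d                          ≡⟨ +-comm r′ (suc d) ⟩
        suc d + r′                          ≡⟨ sym (+-suc d r′) ⟩
        d + suc r′                          ∎)

    dots-beyond : ∀ t → R ≤ t → t < n → dots[ 0 , R ⟩ (perm t) ≡ suc d
    dots-beyond t R≤t t<n = begin
        dots[ 0 , R ⟩ (perm t)                            ≡⟨ dots-split (perm t) 0 r′ R z≤n r′≤R ⟩
        dots[ 0 , r′ ⟩ (perm t) + dots[ r′ , R ⟩ (perm t)
          ≡⟨ cong₂ _+_ (dots-none (perm t) 0 r′ z≤n none) (dots-all (perm t) r′ R r′≤R all) ⟩
        R ∸ r′                                           ≡⟨ cong (_∸ r′) (sym r′+1+d≡R) ⟩
        r′ + suc d ∸ r′                                  ≡⟨ m+n∸m≡n r′ (suc d) ⟩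
        suc d                                          ∎
      where
      open ≡-Reasoning
      none : ∀ i → 0 ≤ i → i < r′ → C ≤ perm t i
      none i _ i<r′ = noDot-before t i (<-≤-trans (<-≤-trans i<r′ r′≤R) R≤t) i<r′
      all : ∀ i → r′ ≤ i → i < R → perm t i < C
      all i r′≤i i<R = dot-before t i (<-≤-trans i<R R≤t) r′≤i (<-≤-trans (s≤s i<R) (≤-trans (s≤s R≤t) t<n))

    representatives : Representatives parametrization r′ (suc d)
    representatives = record
      { within = subst (_≤ n) (sym r′+1+d≡R) R≤n
      ; dots = λ t r′≤t t<R → dots-inside t r′≤t (subst (t <_) r′+1+d≡R t<R)
      ; separated = separated
      ; complete = complete
      }
      where
      separated : ∀ t t′ → r′ ≤ t → t < t′ → t′ < r′ + suc d →
                  Σ ℕ λ i → i < R × (perm t′ i < C ⊎ perm t i < C) × perm t i ≢ perm t′ i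
      separated t t′ r′≤t t<t′ t′<r′+1+d =
        t , <-trans t<t′ t′<R , inj₁ (dot-before t′ t t<t′ r′≤t 1+t<n) ,
        λ e → 0≢1+n (rev-injective 0 (suc t) 0<n 1+t<n (trans (sym (perm-at t)) (trans e (perm-before t′ t t<t′))))
        where
        t′<R = subst (t′ <_) r′+1+d≡R t′<r′+1+d
        1+t<n = <-≤-trans (≤-<-trans t<t′ t′<R) R≤n
      complete : ∀ t → t < n → dots[ 0 , R ⟩ (perm t) ≡ d →
                 Σ ℕ λ t′ → r′ ≤ t′ × t′ < r′ + suc d × AgreeOnDots (perm t) (perm t′)
      complete t t<n d-dots with <-≤-connex t r′ | <-≤-connex t R
      ... | inj₂ r′≤t | inj₁ t<R = t , r′≤t , subst (t <_) (sym r′+1+d≡R) t<R , (λ _ _ → inj₁ refl)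
      ... | inj₂ _ | inj₂ R≤t = ⊥-elim (1+n≢n (trans (sym (dots-beyond t R≤t t<n)) d-dots))
      ... | inj₁ t<r′ | _ = r′ , ≤-refl , m<m+n r′ (s≤s z≤n) , sameDots
        where
        r′<r = subst (r′ <_) 1+r′≡r (n<1+n r′)
        sameDots : AgreeOnDots (perm t) (perm r′)
        sameDots i i<R with place t i | place r′ i
        ... | before i<t | before i<r′ = inj₁ (trans (perm-before t i i<t) (sym (perm-before r′ i i<r′)))
        ... | before i<t | at refl = ⊥-elim (<-asym i<t t<r′)
        ... | before i<t | after r′<i = ⊥-elim (<-asym (<-trans i<t t<r′) r′<i)
        ... | at refl | before i<r′ = inj₂ (max-noDot t , noDot-before r′ t i<r′ i<r′)
        ... | at refl | at refl = inj₁ refl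
        ... | at refl | after r′<i = ⊥-elim (<-asym t<r′ r′<i)
        ... | after t<i | before i<r′ =
          inj₂ (subst (C ≤_) (sym (perm-after t i t<i)) (rev-noDot i (<-trans i<r′ r′<r)) , noDot-before r′ i i<r′ i<r′)
        ... | after t<i | at refl =
          inj₂ (subst (C ≤_) (sym (perm-after t r′ t<i)) (rev-noDot r′ r′<r) , max-noDot r′)
        ... | after t<i | after r′<i = inj₁ (trans (perm-after t i t<i) (sym (perm-after r′ i r′<i)))

    hasCard₂ : HasCard (InSτ τ₂ d c r) (suc d)
    hasCard₂ = hasCard parametrization representatives

  -- Without empty rows every row carries a dot, so the corner only sees the position t of the maximum, up to t = d.
  module NoEmptyRows (r≡0 : r ≡ 0) (0<c : 0 < c) where
    R≡d : R ≡ d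
    R≡d = trans (cong (d +_) r≡0) (+-identityʳ d)

    R<n : R < n
    R<n = +-monoˡ-< r (m<m+n d 0<c)

    n≡C : n ≡ C
    n≡C = trans (cong (C +_) r≡0) (+-identityʳ C)

    dot : ∀ t i → perm t i < C
    dot t i = subst (perm t i <_) n≡C (rev<n 0<n (rank t i))

    representatives : Representatives parametrization 0 (suc d)
    representatives = record
      { within = subst (_≤ n) (cong suc R≡d) R<n
      ; dots = λ t _ _ → trans (dots-all (perm t) 0 R z≤n (λ i _ _ → dot t i)) R≡d
      ; separated = separated
      ; complete = complete
      }
      where
      separated : ∀ t t′ → 0 ≤ t → t < t′ → t′ < suc d →
                  Σ ℕ λ i → i < R × (perm t′ i < C ⊎ perm t i < C) × perm t i ≢ perm t′ i
      separated t t′ _ t<t′ t′≤d = t , t<R , inj₁ (dot t′ t) ,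
        λ e → 0≢1+n (rev-injective 0 (suc t) 0<n (≤-<-trans t<R R<n) (trans (sym (perm-at t)) (trans e (perm-before t′ t t<t′))))
        where t<R = subst (t <_) (sym R≡d) (<-≤-trans t<t′ (≤-pred t′≤d))
      complete : ∀ t → t < n → dots[ 0 , R ⟩ (perm t) ≡ d →
                 Σ ℕ λ t′ → 0 ≤ t′ × t′ < suc d × AgreeOnDots (perm t) (perm t′)
      complete t _ _ with <-≤-connex t (suc d)
      ... | inj₁ t≤d = t , z≤n , t≤d , (λ _ _ → inj₁ refl)
      ... | inj₂ d<t = d , z≤n , n<1+n d , λ i i<R → let i<d = subst (i <_) R≡d i<R in
              inj₁ (trans (perm-before t i (<-trans i<d d<t)) (sym (perm-before d i i<d)))

    hasCard₂ : HasCard (InSτ τ₂ d c r) (suc d)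
    hasCard₂ = hasCard parametrization representatives

-- Avoiders of {213, 231, 312}: increasing up to position t, then decreasing from the maximum

module Avoiders₃ (n : ℕ) (0<n : 0 < n) where
  open Reversal n
  open Avoiders₁ n 0<n using (m; 1+m≡n; m<n; i<m⇒1+i<n)

  perm : ℕ → ℕ → ℕ
  perm t i with i <? t
  ... | yes _ = i
  ... | no _ = rev (i ∸ t)

  perm-before : ∀ t i → i < t → perm t i ≡ i
  perm-before t i i<t with i <? t
  ... | yes _ = refl
  ... | no i≮t = contradiction i<t i≮t

  perm-from : ∀ t i → t ≤ i → perm t i ≡ rev (i ∸ t)
  perm-from t i t≤i with i <? t
  ... | yes i<t = ⊥-elim (<⇒≱ i<t t≤i)
  ... | no _ = refl

  perm-at : ∀ t → perm t t ≡ rev 0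
  perm-at t = trans (perm-from t t ≤-refl) (cong rev (n∸n≡0 t))

  ∸<n : ∀ t i → i < n → i ∸ t < n
  ∸<n t i i<n = ≤-<-trans (m∸n≤m i t) i<n

  t≤rev : ∀ t i → t ≤ i → i < n → t ≤ rev (i ∸ t)
  t≤rev t i t≤i i<n = +-cancelʳ-≤ (suc (i ∸ t)) t (rev (i ∸ t))
    (subst₂ _≤_ (sym (trans (+-suc t (i ∸ t)) (cong suc (m+[n∸m]≡n t≤i)))) (sym (rev+ (i ∸ t) (∸<n t i i<n))) i<n)

  perm-< : ∀ t i → i < n → perm t i < n
  perm-< t i i<n with <-≤-connex i t
  ... | inj₁ i<t = subst (_< n) (sym (perm-before t i i<t)) i<n
  ... | inj₂ t≤i = subst (_< n) (sym (perm-from t i t≤i)) (rev<n 0<n (i ∸ t))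

  perm-injective : ∀ t i j → i < n → j < n → perm t i ≡ perm t j → i ≡ j
  perm-injective t i j i<n j<n e with <-≤-connex i t | <-≤-connex j t
  ... | inj₁ i<t | inj₁ j<t = trans (sym (perm-before t i i<t)) (trans e (perm-before t j j<t))
  ... | inj₁ i<t | inj₂ t≤j =
    ⊥-elim (<⇒≱ i<t (subst (t ≤_) (sym (trans (sym (perm-before t i i<t)) (trans e (perm-from t j t≤j)))) (t≤rev t j t≤j j<n)))
  ... | inj₂ t≤i | inj₁ j<t =
    ⊥-elim (<⇒≱ j<t (subst (t ≤_) (sym (trans (sym (perm-before t j j<t)) (trans (sym e) (perm-from t i t≤i)))) (t≤rev t i t≤i i<n)))
  ... | inj₂ t≤i | inj₂ t≤j =
    ∸-cancelʳ-≡ t≤i t≤j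
      (rev-injective _ _ (∸<n t i i<n) (∸<n t j j<n) (trans (sym (perm-from t i t≤i)) (trans e (perm-from t j t≤j))))

  perm-ascends-before : ∀ t i j → i < j → j < n → i < t → perm t i < perm t j
  perm-ascends-before t i j i<j j<n i<t with <-≤-connex j t
  ... | inj₁ j<t = subst₂ _<_ (sym (perm-before t i i<t)) (sym (perm-before t j j<t)) i<j
  ... | inj₂ t≤j = subst₂ _<_ (sym (perm-before t i i<t)) (sym (perm-from t j t≤j)) (<-≤-trans i<t (t≤rev t j t≤j j<n))

  perm-descends-from : ∀ t i j → t ≤ i → i < j → j < n → perm t j < perm t i
  perm-descends-from t i j t≤i i<j j<n = subst₂ _<_ (sym (perm-from t j (≤-trans t≤i (<⇒≤ i<j)))) (sym (perm-from t i t≤i))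
    (rev-< (i ∸ t) (j ∸ t) (∸-monoˡ-< i<j t≤i) (∸<n t j j<n))

  perm-avoids : ∀ t → t < n → (σ : Fin n → Fin n) → IsPerm σ → σ ≗ℕ perm t → Avoids τ₃ σ
  perm-avoids t t<n σ inj agree = no213 ∷ no231 ∷ no312 ∷ []
    where
    s = ⟦ σ ⟧
    descent⇒from : ∀ i j → i < j → j < n → s j < s i → t ≤ i
    descent⇒from i j i<j j<n lt with <-≤-connex i t
    ... | inj₂ t≤i = t≤i
    ... | inj₁ i<t =
      ⊥-elim (<-asym lt (subst₂ _<_ (sym (agree i (<-trans i<j j<n))) (sym (agree j j<n)) (perm-ascends-before t i j i<j j<n i<t)))
    descends : ∀ i j → t ≤ i → i < j → j < n → s j < s i
    descends i j t≤i i<j j<n = subst₂ _<_ (sym (agree j j<n)) (sym (agree i (<-trans i<j j<n))) (perm-descends-from t i j t≤i i<j j<n)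
    no213 : ¬ Contains σ (patFun p213)
    no213 c with contains⇒occurrence inverse₂₁₃ σ inj c
    ... | i , j , k , (i<j , j<k , k<n) , j↗i , i↗k =
      <-asym (<-trans j↗i i↗k) (descends j k (≤-trans (descent⇒from i j i<j (<-trans j<k k<n) j↗i) (<⇒≤ i<j)) j<k k<n)
    no231 : ¬ Contains σ (patFun p231)
    no231 c with contains⇒occurrence inverse₂₃₁ σ inj c
    ... | i , j , k , (i<j , j<k , k<n) , k↗i , i↗j =
      <-asym i↗j (descends i j (descent⇒from i k (<-trans i<j j<k) k<n k↗i) i<j (<-trans j<k k<n))
    no312 : ¬ Contains σ (patFun p312)
    no312 c with contains⇒occurrence inverse₃₁₂ σ inj c
    ... | i , j , k , (i<j , j<k , k<n) , j↗k , k↗i =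
      <-asym j↗k (descends j k (≤-trans (descent⇒from i j i<j (<-trans j<k k<n) (<-trans j↗k k↗i)) (<⇒≤ i<j)) j<k k<n)

  module Classification (σ : Fin n → Fin n) (inj : IsPerm σ)
    (¬213 : ¬ Contains σ (patFun p213)) (¬231 : ¬ Contains σ (patFun p231)) (¬312 : ¬ Contains σ (patFun p312)) where

    s : ℕ → ℕ
    s = ⟦ σ ⟧

    Descent : ℕ → Set
    Descent i = s (suc i) < s i

    descent-propagates : ∀ i → suc i < m → Descent i → Descent (suc i)
    descent-propagates i 1+i<m down = middle-last
      where
      2+i<n = i<m⇒1+i<n 1+i<m
      i<2+i = <-trans (n<1+n i) (n<1+n (suc i))
      positions : i < suc i × suc i < suc (suc i) × suc (suc i) < n
      positions = n<1+n i , n<1+n (suc i) , 2+i<n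
      middle-last : s (suc (suc i)) < s (suc i)
      middle-last with ⟦⟧-<⊎> σ inj (suc (suc i)) (suc i) 2+i<n (<-trans 1+i<m m<n) 1+n≢n
      ... | inj₁ down′ = down′
      ... | inj₂ up with ⟦⟧-<⊎> σ inj i (suc (suc i)) (<-trans i<2+i 2+i<n) 2+i<n (<⇒≢ i<2+i)
      ...   | inj₁ first<last = ⊥-elim (¬213 (occurrence⇒contains inverse₂₁₃ σ inj (i , suc i , suc (suc i) , positions , down , first<last)))
      ...   | inj₂ last<first = ⊥-elim (¬312 (occurrence⇒contains inverse₃₁₂ σ inj (i , suc i , suc (suc i) , positions , up , last<first)))

    module Shape (p : ℕ) (p≤m : p ≤ m)
      (no-descent : ∀ i → i < m → i < p → ¬ Descent i) (descent : ∀ i → i < m → p ≤ i → Descent i) where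

      p<n : p < n
      p<n = ≤-<-trans p≤m m<n

      ascends : AscendsBelow s (suc p)
      ascends k 1+k<1+p with ⟦⟧-<⊎> σ inj k (suc k) (<-trans k<m m<n) (i<m⇒1+i<n k<m) (<⇒≢ (n<1+n k))
        where k<m = <-≤-trans (≤-pred 1+k<1+p) p≤m
      ... | inj₁ up = up
      ... | inj₂ down = ⊥-elim (no-descent k (<-≤-trans (≤-pred 1+k<1+p) p≤m) (≤-pred 1+k<1+p) down)

      descends : DescendsOn s p n
      descends i p≤i 1+i<n = descent i (≤-pred (subst (suc i <_) (sym 1+m≡n) 1+i<n)) p≤i

      below-last : ∀ i → i < p → s i < s m
      below-last i i<p with m≤n⇒m<n∨m≡n p≤m
      ... | inj₂ refl = ascent-< s ascends i p i<p ≤-refl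
      ... | inj₁ p<m with ⟦⟧-<⊎> σ inj i m (<-trans i<p (<-trans p<m m<n)) m<n (<⇒≢ (<-trans i<p p<m))
      ...   | inj₁ i↗m = i↗m
      ...   | inj₂ m↘i = ⊥-elim (¬231 (occurrence⇒contains inverse₂₃₁ σ inj (i , p , m , (i<p , p<m , m<n) , m↘i , i↗p)))
        where
        i↗p : s i < s p
        i↗p = ascent-< s ascends i p i<p ≤-refl

      at-least-index : ∀ i → i ≤ p → i ≤ s i
      at-least-index i i≤p = ≤-trans (m≤n+m i (s 0)) (ascent′ s ascends 0 i z≤n (s≤s i≤p))

      last≤p : s m ≤ p
      last≤p = +-cancelʳ-≤ (m ∸ p) (s m) p (subst (s m + (m ∸ p) ≤_) (sym (m+[n∸m]≡n p≤m)) chain)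
        where
        chain : s m + (m ∸ p) ≤ m
        chain = ≤-trans (descent′ s descends p m ≤-refl p≤m m<n) (≤-pred (subst (s p <_) (sym 1+m≡n) (⟦⟧-< σ p p<n)))

      p≤last : p ≤ s m
      p≤last = all-<⇒≤ (λ i i<p → ≤-<-trans (at-least-index i (<⇒≤ i<p)) (below-last i i<p))

      value-before : ∀ i → i < p → s i ≡ i
      value-before i i<p with m≤n⇒∃[o]m+o≡n i<p
      ... | k , 1+i+k≡p = ≤-antisym (+-cancelʳ-≤ k (s i) i (≤-pred chain)) (at-least-index i (<⇒≤ i<p))
        where
        chain : s i + k < suc (i + k)
        chain = begin-strict
          s i + k              ≡⟨ cong (s i +_) (sym (m+n∸m≡n i k)) ⟩
          s i + (i + k ∸ i)    ≤⟨ ascent′ s ascends i (i + k) (m≤m+n i k) (s≤s (<⇒≤ (≤-reflexive 1+i+k≡p))) ⟩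
          s (i + k)            <⟨ below-last (i + k) (≤-reflexive 1+i+k≡p) ⟩
          s m                  ≤⟨ last≤p ⟩
          p                    ≡⟨ sym 1+i+k≡p ⟩
          suc (i + k)          ∎
          where open ≤-Reasoning

      value-from : ∀ i → p ≤ i → i < n → s i + suc (i ∸ p) ≡ n
      value-from i p≤i i<n = ≤-antisym upper lower
        where
        upper : s i + suc (i ∸ p) ≤ n
        upper = subst (_≤ n) (sym (+-suc (s i) (i ∸ p))) (≤-<-trans (descent′ s descends p i ≤-refl p≤i i<n) (⟦⟧-< σ p p<n))
        i≤m : i ≤ m
        i≤m = ≤-pred (subst (i <_) (sym 1+m≡n) i<n)
        reorder : ∀ a x y → suc (a + x + y) ≡ suc (a + y + x)
        reorder = solve-∀
        lower : n ≤ s i + suc (i ∸ p)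
        lower = begin
          n                              ≡⟨ sym 1+m≡n ⟩
          suc m                          ≡⟨ cong suc (sym (m+[n∸m]≡n i≤m)) ⟩
          suc (i + (m ∸ i))              ≡⟨ cong (λ z → suc (z + (m ∸ i))) (sym (m+[n∸m]≡n p≤i)) ⟩
          suc (p + (i ∸ p) + (m ∸ i))    ≡⟨ reorder p (i ∸ p) (m ∸ i) ⟩
          suc (p + (m ∸ i) + (i ∸ p))    ≤⟨ s≤s (+-monoˡ-≤ (i ∸ p) (≤-trans (+-monoˡ-≤ (m ∸ i) p≤last)
                                                                            (descent′ s descends i m p≤i i≤m m<n))) ⟩
          suc (s i + (i ∸ p))            ≡⟨ sym (+-suc (s i) (i ∸ p)) ⟩
          s i + suc (i ∸ p)              ∎
          where open ≤-Reasoning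

      value : ∀ i → i < n → s i ≡ perm p i
      value i i<n with <-≤-connex i p
      ... | inj₁ i<p = trans (value-before i i<p) (sym (perm-before p i i<p))
      ... | inj₂ p≤i = trans (+suc≡⇒rev (∸<n p i i<n) (value-from i p≤i i<n)) (sym (perm-from p i p≤i))

  classify : (σ : Fin n → Fin n) → IsPerm σ → Avoids τ₃ σ → Σ ℕ λ t → t < n × σ ≗ℕ perm t
  classify σ inj (¬213 ∷ ¬231 ∷ ¬312 ∷ [])
    with threshold Descent (λ i → ⟦ σ ⟧ (suc i) <? ⟦ σ ⟧ i) m (stepwise⇒upward Descent m descent-propagates)
    where open Classification σ inj ¬213 ¬231 ¬312
  ... | p , p≤m , no-descent , descent = p , Shape.p<n p p≤m no-descent descent , Shape.value p p≤m no-descent descent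
    where open Classification σ inj ¬213 ¬231 ¬312

  parametrization : Parametrization τ₃ n
  parametrization = record
    { perm = perm
    ; perm-< = λ t i i<n → perm-< t i i<n
    ; perm-injective = λ t i j _ i<n j<n e → perm-injective t i j i<n j<n e
    ; perm-avoids = perm-avoids
    ; classify = classify
    ; perm-distinct = λ t t′ t<t′ t′<n → t , <-trans t<t′ t′<n ,
        λ e → rev0≢ t (≤-<-trans t<t′ t′<n) (trans (sym (perm-at t)) (trans e (perm-before t′ t t<t′)))
    }

module Corners₃ (d c r : ℕ) (0<n : 0 < d + c + r) where
  open Enumeration d c r
  open Avoiders₃ n 0<n

  d≤C : d ≤ C
  d≤C = m≤m+n d c

  d≤R : d ≤ R
  d≤R = m≤m+n d r

  ∸<r : ∀ t i → t ≤ i → i < t + r → i ∸ t < r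
  ∸<r t i t≤i i<t+r = +-cancelˡ-< t (i ∸ t) r (subst (_< t + r) (sym (m+[n∸m]≡n t≤i)) i<t+r)

  r≤∸ : ∀ t i → t + r ≤ i → r ≤ i ∸ t
  r≤∸ t i t+r≤i = +-cancelˡ-≤ t r (i ∸ t) (subst (t + r ≤_) (sym (m+[n∸m]≡n (≤-trans (m≤m+n t r) t+r≤i))) t+r≤i)

  -- The rows t ≤ i < t + r of perm t miss the corner; all others hit it.
  dots-upto-d : ∀ t → t ≤ d → dots[ 0 , R ⟩ (perm t) ≡ d
  dots-upto-d t t≤d = begin
      dots[ 0 , R ⟩ (perm t)
        ≡⟨ dots-split (perm t) 0 t R z≤n (≤-trans t≤d d≤R) ⟩
      dots[ 0 , t ⟩ (perm t) + dots[ t , R ⟩ (perm t)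
        ≡⟨ cong (dots[ 0 , t ⟩ (perm t) +_) (dots-split (perm t) t (t + r) R (m≤m+n t r) t+r≤R) ⟩
      dots[ 0 , t ⟩ (perm t) + (dots[ t , t + r ⟩ (perm t) + dots[ t + r , R ⟩ (perm t))
        ≡⟨ cong₂ _+_ (dots-all (perm t) 0 t z≤n increasing)
                     (cong₂ _+_ (dots-none (perm t) t (t + r) (m≤m+n t r) missing) (dots-all (perm t) (t + r) R t+r≤R decreasing)) ⟩
      t + (R ∸ (t + r))
        ≡⟨ cong (t +_) (trans (cong₂ _∸_ (+-comm d r) (+-comm t r)) ([m+n]∸[m+o]≡n∸o r d t)) ⟩
      t + (d ∸ t)
        ≡⟨ m+[n∸m]≡n t≤d ⟩
      d ∎
    where
    open ≡-Reasoning
    t+r≤R : t + r ≤ R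
    t+r≤R = +-monoˡ-≤ r t≤d
    increasing : ∀ i → 0 ≤ i → i < t → perm t i < C
    increasing i _ i<t = subst (_< C) (sym (perm-before t i i<t)) (<-≤-trans i<t (≤-trans t≤d d≤C))
    missing : ∀ i → t ≤ i → i < t + r → C ≤ perm t i
    missing i t≤i i<t+r = subst (C ≤_) (sym (perm-from t i t≤i)) (rev-noDot (i ∸ t) (∸<r t i t≤i i<t+r))
    decreasing : ∀ i → t + r ≤ i → i < R → perm t i < C
    decreasing i t+r≤i i<R = subst (_< C) (sym (perm-from t i (≤-trans (m≤m+n t r) t+r≤i)))
      (rev-dot (i ∸ t) (∸<n t i (<-≤-trans i<R R≤n)) (r≤∸ t i t+r≤i))

  dots-beyond-d : ∀ t → d < t → 0 < c → 0 < r → suc d ≤ dots[ 0 , R ⟩ (perm t)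
  dots-beyond-d t d<t 0<c 0<r = subst (suc d ≤_) (sym (dots-split (perm t) 0 (suc d) R z≤n 1+d≤R))
    (subst (λ z → suc d ≤ z + dots[ suc d , R ⟩ (perm t)) (sym (dots-all (perm t) 0 (suc d) z≤n first)) (m≤m+n (suc d) _))
    where
    1+d≤R : suc d ≤ R
    1+d≤R = m<m+n d 0<r
    first : ∀ i → 0 ≤ i → i < suc d → perm t i < C
    first i _ i<1+d = subst (_< C) (sym (perm-before t i (<-≤-trans i<1+d d<t))) (<-≤-trans i<1+d (m<m+n d 0<c))

  agree-before-d : ∀ t i → d < t → i < d → perm t i ≡ perm d i
  agree-before-d t i d<t i<d = trans (perm-before t i (<-trans i<d d<t)) (sym (perm-before d i i<d))

  sameDots-without-spareColumns : c ≡ 0 → ∀ t → d < t → AgreeOnDots (perm t) (perm d)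
  sameDots-without-spareColumns c≡0 t d<t i i<R with <-≤-connex i d
  ... | inj₁ i<d = inj₁ (agree-before-d t i d<t i<d)
  ... | inj₂ d≤i = inj₂ (beyond , subst (C ≤_) (sym (perm-from d i d≤i)) (rev-noDot (i ∸ d) i∸d<r))
    where
    i∸d<r : i ∸ d < r
    i∸d<r = ∸<r d i d≤i i<R
    beyond : C ≤ perm t i
    beyond with <-≤-connex i t
    ... | inj₁ i<t = subst (_≤ perm t i) (sym (trans (cong (d +_) c≡0) (+-identityʳ d))) (subst (d ≤_) (sym (perm-before t i i<t)) d≤i)
    ... | inj₂ t≤i = subst (C ≤_) (sym (perm-from t i t≤i)) (rev-noDot (i ∸ t) (≤-<-trans (∸-monoʳ-≤ i (<⇒≤ d<t)) i∸d<r))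

  sameDots-without-emptyRows : r ≡ 0 → ∀ t → d < t → AgreeOnDots (perm t) (perm d)
  sameDots-without-emptyRows r≡0 t d<t i i<R = inj₁ (agree-before-d t i d<t (subst (i <_) (trans (cong (d +_) r≡0) (+-identityʳ d)) i<R))

  -- With a spare column or an empty row, the representatives are t ≤ d.
  representatives : d < n → Representatives parametrization 0 (suc d)
  representatives d<n = record
    { within = d<n
    ; dots = λ t _ t≤d → dots-upto-d t (≤-pred t≤d)
    ; separated = separated
    ; complete = complete
    }
    where
    separated : ∀ t t′ → 0 ≤ t → t < t′ → t′ < suc d →
                Σ ℕ λ i → i < R × (perm t′ i < C ⊎ perm t i < C) × perm t i ≢ perm t′ i
    separated t t′ _ t<t′ t′≤d =
      t , <-≤-trans t<d d≤R , inj₁ (subst (_< C) (sym (perm-before t′ t t<t′)) (<-≤-trans t<d d≤C)) ,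
      λ e → rev0≢ t (≤-<-trans t<d d<n) (trans (sym (perm-at t)) (trans e (perm-before t′ t t<t′)))
      where t<d = <-≤-trans t<t′ (≤-pred t′≤d)
    complete : ∀ t → t < n → dots[ 0 , R ⟩ (perm t) ≡ d →
               Σ ℕ λ t′ → 0 ≤ t′ × t′ < suc d × AgreeOnDots (perm t) (perm t′)
    complete t t<n d-dots with <-≤-connex t (suc d)
    ... | inj₁ t≤d = t , z≤n , t≤d , (λ _ _ → inj₁ refl)
    ... | inj₂ d<t with c ≟ 0 | r ≟ 0
    ...   | yes c≡0 | _ = d , z≤n , n<1+n d , sameDots-without-spareColumns c≡0 t d<t
    ...   | no _ | yes r≡0 = d , z≤n , n<1+n d , sameDots-without-emptyRows r≡0 t d<t
    ...   | no c≢0 | no r≢0 = ⊥-elim (<-irrefl (sym d-dots) (dots-beyond-d t d<t (n≢0⇒n>0 c≢0) (n≢0⇒n>0 r≢0)))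

  hasCard₃ : d < n → HasCard (InSτ τ₃ d c r) (suc d)
  hasCard₃ d<n = hasCard parametrization (representatives d<n)

σ∅ : Fin 0 → Fin 0
σ∅ ()

σ∅-avoids : ∀ {m} (π : Fin (suc m) → Fin (suc m)) → ¬ Contains σ∅ π
σ∅-avoids π (f , _) with f 0F
... | ()

emptyCorner : ∀ τ → Avoids τ σ∅ → HasCard (InSτ τ 0 0 0) 1
emptyCorner τ avoids = [] List.∷ List.[] , All.[] AllPairs.∷ AllPairs.[] , refl , λ ρ → mk⇔ (listed ρ) (λ _ → listed⁻ ρ)
  where
  listed : ∀ ρ → ρ ∈ [] List.∷ List.[] → InSτ τ 0 0 0 ρ
  listed .[] (here refl) = (((λ ()) , (λ ())) , refl , refl , refl) , σ∅ , (λ { {()} }) , (λ ()) , avoids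
  listed⁻ : ∀ ρ → ρ ∈ [] List.∷ List.[]
  listed⁻ [] = here refl

d<d+c+r : ∀ d c r → 0 < c + r → d < d + c + r
d<d+c+r d c r 0<c+r = subst (d <_) (sym (+-assoc d c r)) (m<m+n d 0<c+r)

proposition5p2 : (d c r : ℕ) → ∃ λ N → HasCard (InSτ τ₁ d c r) N × HasCard (InSτ τ₂ d c r) N × HasCard (InSτ τ₃ d c r) N
proposition5p2 zero zero zero = 1 , emptyCorner τ₁ σ∅-avoids₃ , emptyCorner τ₂ σ∅-avoids₃ , emptyCorner τ₃ σ∅-avoids₃
  where
  σ∅-avoids₃ : ∀ {w₁ w₂ w₃} → Avoids (pat w₁ List.∷ pat w₂ List.∷ pat w₃ List.∷ List.[]) σ∅
  σ∅-avoids₃ = σ∅-avoids _ ∷ σ∅-avoids _ ∷ σ∅-avoids _ ∷ []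
proposition5p2 (suc d) zero zero =
  suc d , fullCorner (suc d) (Avoiders₁.parametrization _ 0<n) , fullCorner (suc d) (Avoiders₂.parametrization _ 0<n) ,
          fullCorner (suc d) (Avoiders₃.parametrization _ 0<n)
  where 0<n = s≤s z≤n
proposition5p2 d zero (suc r) =
  suc d , Corners₁.NoSpareColumns.hasCard₁ d 0 (suc r) 0<n refl r refl , Corners₂.EmptyRows.hasCard₂ d 0 (suc r) 0<n r refl ,
          Corners₃.hasCard₃ d 0 (suc r) 0<n d<n
  where
  d<n = d<d+c+r d 0 (suc r) (s≤s z≤n)
  0<n = ≤-<-trans z≤n d<n
proposition5p2 d (suc c) zero =
  suc d , Corners₁.SpareColumns.hasCard₁ d (suc c) 0 0<n (s≤s z≤n) , Corners₂.NoEmptyRows.hasCard₂ d (suc c) 0 0<n refl (s≤s z≤n) ,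
          Corners₃.hasCard₃ d (suc c) 0 0<n d<n
  where
  d<n = d<d+c+r d (suc c) 0 (s≤s z≤n)
  0<n = ≤-<-trans z≤n d<n
proposition5p2 d (suc c) (suc r) =
  suc d , Corners₁.SpareColumns.hasCard₁ d (suc c) (suc r) 0<n (s≤s z≤n) , Corners₂.EmptyRows.hasCard₂ d (suc c) (suc r) 0<n r refl ,
          Corners₃.hasCard₃ d (suc c) (suc r) 0<n d<n
  where
  d<n = d<d+c+r d (suc c) (suc r) (s≤s z≤n)
  0<n = ≤-<-trans z≤n d<n
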